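{- Let $m,d$ be nonnegative integers with $d<q$. Let $0\le i\le r_1(E_1)$ and let $\sigma_1\subseteq E_1$ be such that $E_1\setminus\sigma_1$ is inclusion-minimal in $N_i'$. Put $\sigma_2=\sigma_1\cap E_2$. Then $E_2\setminus\sigma_2$ is inclusion-minimal in $N_j$ for some $j\ge i$.
   Context: Let $q$ be a prime power. $\mathrm{PRM}_q(d,m)$ is the code obtained by evaluating all homogeneous polynomials of degree $d$ in $m+1$ variables over $\mathbb{F}_q$ (including $0$) at fixed representatives of all points of $\mathbb{P}^m_q$; $\mathrm{RM}_q(d,m)$ is the code obtained by evaluating all polynomials of degree at most $d$ in $m$ variables over $\mathbb{F}_q$ at all points of $\mathbb{A}^m_q=\mathbb{F}_q^m$. Let $H\subset\mathbb{P}^m_q$ be a hyperplane $x_H=0$ and identify $\mathbb{A}^m_q=\mathbb{P}^m_q\setminus H$, choosing for its points the representatives with $x_H=1$. Let $E_1=\mathbb{P}^m_q$ and $E_2=\mathbb{A}^m_q\subseteq E_1$. Let $M_1$ (resp. $M_2$) be the parity check matroid of $\mathrm{PRM}_q(d,m)$ on $E_1$ (resp. of $\mathrm{RM}_q(d,m)$ on $E_2$), i.e. the matroid whose independent sets are the index sets of linearly independent columns of a parity check matrix, with rank functions $r_1,r_2$ and nullities $n_1(\tau)=|\tau|-r_1(\tau)$, $n_2(\sigma)=|\sigma|-r_2(\sigma)$. Set $N_i'=\{\tau\subseteq E_1: n_1(\tau)=i\}$ and $N_i=\{\sigma\subseteq E_2: n_2(\sigma)=i\}$. -}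

module Defs where

open import Level using (Level; _⊔_)
open import Algebra.Bundles using (CommutativeRing)
open import Data.Nat as ℕ using (ℕ; zero; _≤_)
open import Data.Nat.Primality using (Prime)
open import Data.Fin as Fin using (Fin; zero; suc; punchIn)
open import Data.List using ([]; _∷_)
open import Data.Fin.Subset as Sub using (Subset; _⊆_; ∁; ∣_∣; _∈_)
open import Data.Vec using (tabulate; lookup)
open import Data.List as List using (List)
open import Data.List.Relation.Unary.All using (All)
open import Data.Product using (Σ; ∃; ∃-syntax; _×_; _,_)
open import Relation.Nullary using (¬_)
open import Relation.Binary.PropositionalEquality using (_≡_)

IsPrimePower : ℕ → Set
IsPrimePower q = ∃[ p ] ∃[ k ] (Prime p × q ≡ p ℕ.^ ℕ.suc k)

record FiniteField (c ℓ : Level) (q : ℕ) : Set (Level.suc (c ⊔ ℓ)) where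
  field
    cring : CommutativeRing c ℓ
  open CommutativeRing cring public
  field
    0≉1     : ¬ (0# ≈ 1#)
    inverse : ∀ x → ¬ (x ≈ 0#) → ∃[ y ] (x * y ≈ 1#)
    enum    : Fin q → Carrier
    enum-surj : ∀ x → ∃[ i ] (enum i ≈ x)
    enum-inj  : ∀ i j → enum i ≈ enum j → i ≡ j

module Over {c ℓ : Level} {q : ℕ} (F : FiniteField c ℓ q) where
  open FiniteField F using (Carrier; _≈_; _+_; _*_; 0#; 1#)

  sumFin : ∀ {n} → (Fin n → Carrier) → Carrier
  sumFin {zero}  f = 0#
  sumFin {ℕ.suc n} f = f zero + sumFin (λ i → f (suc i))

  prodFin : ∀ {n} → (Fin n → Carrier) → Carrier
  prodFin {zero}  f = 1#
  prodFin {ℕ.suc n} f = f zero * prodFin (λ i → f (suc i))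

  pow : Carrier → ℕ → Carrier
  pow x zero    = 1#
  pow x (ℕ.suc k) = x * pow x k

  degree : ∀ {n} → (Fin n → ℕ) → ℕ
  degree {zero}  e = 0
  degree {ℕ.suc n} e = e zero ℕ.+ degree (λ i → e (suc i))

  Poly : ℕ → Set c
  Poly n = List (Carrier × (Fin n → ℕ))

  evalMon : ∀ {n} → (Fin n → ℕ) → (Fin n → Carrier) → Carrier
  evalMon e x = prodFin (λ j → pow (x j) (e j))

  eval : ∀ {n} → Poly n → (Fin n → Carrier) → Carrier
  eval []             x = 0#
  eval ((a , e) ∷ f) x = a * evalMon e x + eval f x

  -- homogeneous of degree d (the zero polynomial included)
  Homogeneous : ∀ {n} → ℕ → Poly n → Set c
  Homogeneous d f = All (λ t → degree (Data.Product.proj₂ t) ≡ d) f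

  DegAtMost : ∀ {n} → ℕ → Poly n → Set c
  DegAtMost d f = All (λ t → degree (Data.Product.proj₂ t) ≤ d) f

  Vector : ℕ → Set c
  Vector n = Fin n → Carrier

  Code : ℕ → Set (Level.suc (c ⊔ ℓ))
  Code n = Vector n → Set (c ⊔ ℓ)

  IsParityCheck : ∀ {n r} → Code n → (Fin r → Fin n → Carrier) → Set (c ⊔ ℓ)
  IsParityCheck {n} C H =
    ∀ (x : Vector n) →
      ((∀ row → sumFin (λ e → H row e * x e) ≈ 0#) → C x) ×
      (C x → ∀ row → sumFin (λ e → H row e * x e) ≈ 0#)

  IndepCols : ∀ {n r} → (Fin r → Fin n → Carrier) → Subset n → Set (c ⊔ ℓ)
  IndepCols {n} H τ =
    ∀ (a : Vector n) → (∀ e → ¬ (e ∈ τ) → a e ≈ 0#) →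
      (∀ row → sumFin (λ e → a e * H row e) ≈ 0#) → ∀ e → a e ≈ 0#

  IsRank : ∀ {n r} → (Fin r → Fin n → Carrier) → Subset n → ℕ → Set (c ⊔ ℓ)
  IsRank H τ k =
    (∃[ I ] (I ⊆ τ × IndepCols H I × ∣ I ∣ ≡ k)) ×
    (∀ I → I ⊆ τ → IndepCols H I → ∣ I ∣ ≤ k)

  HasNullity : ∀ {n r} → (Fin r → Fin n → Carrier) → Subset n → ℕ → Set (c ⊔ ℓ)
  HasNullity H τ i = ∃[ k ] (IsRank H τ k × ∣ τ ∣ ≡ k ℕ.+ i)

  MinimalNullity : ∀ {n r} → (Fin r → Fin n → Carrier) → ℕ → Subset n → Set (c ⊔ ℓ)
  MinimalNullity {n} H i τ =
    HasNullity H τ i × (∀ (τ' : Subset n) → τ' ⊆ τ → HasNullity H τ' i → τ ⊆ τ')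

  -- The points of P^m: N points, point p having the fixed representative rep p,
  -- which form a system of representatives of (F^{m+1} ∖ 0)/F^*.
  IsProjReps : (m N : ℕ) → (Fin N → Vector (ℕ.suc m)) → Set (c ⊔ ℓ)
  IsProjReps m N rep =
    (∀ p → ¬ (∀ j → rep p j ≈ 0#)) ×
    (∀ (v : Vector (ℕ.suc m)) → ¬ (∀ j → v j ≈ 0#) →
       ∃[ p ] ∃[ λ' ] (∀ j → v j ≈ λ' * rep p j)) ×
    (∀ p p' λ' → (∀ j → rep p j ≈ λ' * rep p' j) → p ≡ p')

  PRM : (d m : ℕ) {N : ℕ} → (Fin N → Vector (ℕ.suc m)) → Code N
  PRM d m rep x = ∃[ f ] (Homogeneous d f × (∀ p → x p ≈ eval {ℕ.suc m} f (rep p)))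

  RM : (d m : ℕ) {n : ℕ} → (Fin n → Vector m) → Code n
  RM d m pt x = ∃[ f ] (DegAtMost d f × (∀ j → x j ≈ eval {m} f (pt j)))

  -- intersection of σ ⊆ Fin N with the image of an embedding ι : Fin n → Fin N,
  -- viewed as a subset of Fin n
  restrict : ∀ {n N} → (Fin n → Fin N) → Subset N → Subset n
  restrict ι σ = tabulate (λ j → lookup σ (ι j))

-- Restriction to the affine chart, x ↦ x ∘ ι, maps PRM_q(d,m) injectively into RM_q(d,m):
-- setting x_H = 1 turns a form of degree d into a polynomial of degree at most d, and since
-- d < q a form vanishing on the affine chart vanishes everywhere (along the line e_H + t v
-- it is a polynomial in t of degree at most d with q roots and leading coefficient f(v)).
-- In the parity check matroids, where dependencies are codewords, this has two consequences.
-- A basis of E₂ ∖ σ₂ together with the points of E₁ ∖ σ₁ at infinity is independent in M₁,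
-- which gives i ≤ j. And as E₁ ∖ σ₁ is minimal, each of its points lies on a codeword
-- supported in it; restricting that codeword shows that E₂ ∖ σ₂ has no coloops, and removing
-- a non-coloop lowers the nullity, so E₂ ∖ σ₂ is minimal.

module Submission where

open import Defs
open import Level using (Level; _⊔_)
open import Data.Bool.Base using (Bool; true; false; not)
open import Data.Nat as ℕ using (ℕ; zero; suc; _≤_; _<_; z≤n; s≤s)
import Data.Nat.Properties as ℕₚ
open import Data.Fin using (Fin; zero; suc; punchIn)
import Data.Fin.Properties as Finₚ
open import Data.Fin.Subset
  using (Subset; _∈_; _∉_; _⊆_; ∁; ∣_∣; _∩_; _∪_; _─_; _-_; ⁅_⁆; ⊥; ⊤; inside; outside)
open import Data.Fin.Subset.Properties
open import Data.Vec.Functional using (insertAt)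
open import Data.Vec.Functional.Properties using (insertAt-lookup; insertAt-punchIn)
open import Data.Vec as Vec using (Vec; []; _∷_; here; there; lookup; tabulate)
import Data.List.Base as List
open import Data.List.Base using ([]; _∷_)
open import Data.List.Relation.Unary.All using ([]; _∷_)
open import Data.List.Relation.Unary.All.Properties using (gmap⁺)
import Data.Vec.Properties as Vecₚ
open import Data.Product using (∃; ∃-syntax; _×_; _,_; proj₁; proj₂; map₂)
open import Data.Empty using (⊥-elim)
open import Data.Sum using (_⊎_; inj₁; inj₂; [_,_]′)
open import Function using (_∘_; case_of_)
open import Relation.Nullary using (¬_; Dec; yes; no; contradiction)
import Relation.Nullary.Decidable as Dec
open import Relation.Nullary.Decidable using (¬?; _×-dec_; _→-dec_)
open import Relation.Binary.PropositionalEquality as ≡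
  using (_≡_; _≢_; refl; sym; trans; cong; cong₂; subst)

module SubsetLemmas where
  open import Data.Nat.Base using (_+_)

  ∈⇒lookup : ∀ {n} {x : Fin n} {p : Subset n} → x ∈ p → lookup p x ≡ true
  ∈⇒lookup = Vecₚ.[]=⇒lookup

  lookup⇒∈ : ∀ {n} {x : Fin n} {p : Subset n} → lookup p x ≡ true → x ∈ p
  lookup⇒∈ {x = x} {p} = Vecₚ.lookup⇒[]= x p

  x∈p─q⇒x∉q : ∀ {n} {x : Fin n} (p q : Subset n) → x ∈ p ─ q → x ∉ q
  x∈p─q⇒x∉q (inside ∷ p) (outside ∷ q) here ()
  x∈p─q⇒x∉q (_ ∷ p) (_ ∷ q) (there x∈) (there x∈q) = x∈p─q⇒x∉q p q x∈ x∈q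

  x∉p-x : ∀ {n} (p : Subset n) (x : Fin n) → x ∉ p - x
  x∉p-x p x x∈ = x∈p─q⇒x∉q p ⁅ x ⁆ x∈ (x∈⁅x⁆ x)

  ∣p∣≡∣p∩q∣+∣p─q∣ : ∀ {n} (p q : Subset n) → ∣ p ∣ ≡ ∣ p ∩ q ∣ + ∣ p ─ q ∣
  ∣p∣≡∣p∩q∣+∣p─q∣ [] [] = refl
  ∣p∣≡∣p∩q∣+∣p─q∣ (inside ∷ p) (inside ∷ q) = cong suc (∣p∣≡∣p∩q∣+∣p─q∣ p q)
  ∣p∣≡∣p∩q∣+∣p─q∣ (inside ∷ p) (outside ∷ q) =
    trans (cong suc (∣p∣≡∣p∩q∣+∣p─q∣ p q)) (sym (ℕₚ.+-suc ∣ p ∩ q ∣ ∣ p ─ q ∣))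
  ∣p∣≡∣p∩q∣+∣p─q∣ (outside ∷ p) (inside ∷ q) = ∣p∣≡∣p∩q∣+∣p─q∣ p q
  ∣p∣≡∣p∩q∣+∣p─q∣ (outside ∷ p) (outside ∷ q) = ∣p∣≡∣p∩q∣+∣p─q∣ p q

  q⊆p⇒∣p∣≡∣q∣+∣p─q∣ : ∀ {n} {p q : Subset n} → q ⊆ p → ∣ p ∣ ≡ ∣ q ∣ + ∣ p ─ q ∣
  q⊆p⇒∣p∣≡∣q∣+∣p─q∣ {p = p} {q} q⊆p = trans (∣p∣≡∣p∩q∣+∣p─q∣ p q) (cong (λ r → ∣ r ∣ + ∣ p ─ q ∣) p∩q≡q)
    where
    p∩q≡q : p ∩ q ≡ q
    p∩q≡q = ⊆-antisym (p∩q⊆q p q) λ x∈q → x∈p∩q⁺ (q⊆p x∈q , x∈q)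

  x∈p⇒∣p∣≡1+∣p-x∣ : ∀ {n} {x : Fin n} {p : Subset n} → x ∈ p → ∣ p ∣ ≡ suc ∣ p - x ∣
  x∈p⇒∣p∣≡1+∣p-x∣ {x = x} {p} x∈p = trans (q⊆p⇒∣p∣≡∣q∣+∣p─q∣ ⁅x⁆⊆p) (cong (_+ ∣ p - x ∣) (∣⁅x⁆∣≡1 x))
    where
    ⁅x⁆⊆p : ⁅ x ⁆ ⊆ p
    ⁅x⁆⊆p y∈ with x∈⁅y⁆⇒x≡y x y∈
    ... | refl = x∈p

  ∣p∣≤1+∣p-x∣ : ∀ {n} (p : Subset n) (x : Fin n) → ∣ p ∣ ≤ suc ∣ p - x ∣
  ∣p∣≤1+∣p-x∣ p x with x ∈? p
  ... | yes x∈p = ℕₚ.≤-reflexive (x∈p⇒∣p∣≡1+∣p-x∣ x∈p)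
  ... | no x∉p = ℕₚ.m≤n⇒m≤1+n (p⊆q⇒∣p∣≤∣q∣ {p = p} {q = p - x} λ {y} y∈p → x∈p∧x≢y⇒x∈p-y y∈p λ { refl → x∉p y∈p })

  x∉p⇒∣p∪⁅x⁆∣≡1+∣p∣ : ∀ {n} {x : Fin n} {p : Subset n} → x ∉ p → ∣ p ∪ ⁅ x ⁆ ∣ ≡ suc ∣ p ∣
  x∉p⇒∣p∪⁅x⁆∣≡1+∣p∣ {x = x} {p} x∉p =
    trans (x∈p⇒∣p∣≡1+∣p-x∣ (x∈p∪q⁺ {p = p} (inj₂ (x∈⁅x⁆ x)))) (cong (suc ∘ ∣_∣) p∪⁅x⁆-x≡p)
    where
    p∪⁅x⁆-x≡p : (p ∪ ⁅ x ⁆) - x ≡ p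
    p∪⁅x⁆-x≡p = ⊆-antisym ⊆p p⊆
      where
      ⊆p : (p ∪ ⁅ x ⁆) - x ⊆ p
      ⊆p {y} y∈ with x∈p∪q⁻ p ⁅ x ⁆ (p─q⊆p _ ⁅ x ⁆ y∈)
      ... | inj₁ y∈p = y∈p
      ... | inj₂ y∈⁅x⁆ = contradiction y∈⁅x⁆ (x∈p─q⇒x∉q _ ⁅ x ⁆ y∈)
      p⊆ : p ⊆ (p ∪ ⁅ x ⁆) - x
      p⊆ {y} y∈p = x∈p∧x≢y⇒x∈p-y (p⊆p∪q ⁅ x ⁆ y∈p) λ { refl → x∉p y∈p }

  ∣a∷b∷p∣≡∣b∷a∷p∣ : ∀ {n} a b (p : Subset n) → ∣ a ∷ b ∷ p ∣ ≡ ∣ b ∷ a ∷ p ∣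
  ∣a∷b∷p∣≡∣b∷a∷p∣ true true p = refl
  ∣a∷b∷p∣≡∣b∷a∷p∣ true false p = refl
  ∣a∷b∷p∣≡∣b∷a∷p∣ false true p = refl
  ∣a∷b∷p∣≡∣b∷a∷p∣ false false p = refl

  ∣b∷p∣≡∣b∷[]∣+∣p∣ : ∀ {n} b (p : Subset n) → ∣ b ∷ p ∣ ≡ ∣ b ∷ [] ∣ + ∣ p ∣
  ∣b∷p∣≡∣b∷[]∣+∣p∣ true p = refl
  ∣b∷p∣≡∣b∷[]∣+∣p∣ false p = refl

  ∣p[x]∷p[x]≔b∣≡∣b∷p∣ : ∀ {n} (p : Subset n) x b → ∣ lookup p x ∷ (p Vec.[ x ]≔ b) ∣ ≡ ∣ b ∷ p ∣
  ∣p[x]∷p[x]≔b∣≡∣b∷p∣ (a ∷ p) zero b = ∣a∷b∷p∣≡∣b∷a∷p∣ a b p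
  ∣p[x]∷p[x]≔b∣≡∣b∷p∣ (a ∷ p) (suc x) b = begin
    ∣ lookup p x ∷ a ∷ (p Vec.[ x ]≔ b) ∣ ≡⟨ ∣a∷b∷p∣≡∣b∷a∷p∣ (lookup p x) a (p Vec.[ x ]≔ b) ⟩
    ∣ a ∷ lookup p x ∷ (p Vec.[ x ]≔ b) ∣ ≡⟨ cons a (lookup p x ∷ (p Vec.[ x ]≔ b)) (b ∷ p)
                                                (∣p[x]∷p[x]≔b∣≡∣b∷p∣ p x b) ⟩
    ∣ a ∷ b ∷ p ∣                         ≡⟨ ∣a∷b∷p∣≡∣b∷a∷p∣ a b p ⟩
    ∣ b ∷ a ∷ p ∣                         ∎
    where
    open ≡.≡-Reasoning
    cons : ∀ {n} c (u v : Subset n) → ∣ u ∣ ≡ ∣ v ∣ → ∣ c ∷ u ∣ ≡ ∣ c ∷ v ∣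
    cons true _ _ eq = cong suc eq
    cons false _ _ eq = eq

  largest : ∀ {p} n (Q : Subset n → Set p) → (∀ I → Dec (Q I)) →
    (∀ J → ¬ Q J) ⊎ ∃[ I ] (Q I × ∀ J → Q J → ∣ J ∣ ≤ ∣ I ∣)
  largest zero Q Q? with Q? []
  ... | yes Q[] = inj₂ ([] , Q[] , λ { [] _ → z≤n })
  ... | no ¬Q[] = inj₁ λ { [] → ¬Q[] }
  largest (suc n) Q Q? with largest n (Q ∘ (outside ∷_)) (Q? ∘ (outside ∷_))
                           | largest n (Q ∘ (inside ∷_)) (Q? ∘ (inside ∷_))
  ... | inj₁ ¬Q₀ | inj₁ ¬Q₁ = inj₁ λ { (outside ∷ J) → ¬Q₀ J ; (inside ∷ J) → ¬Q₁ J }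
  ... | inj₂ (I₀ , Q₀ , max₀) | inj₁ ¬Q₁ =
    inj₂ (outside ∷ I₀ , Q₀ , λ { (outside ∷ J) QJ → max₀ J QJ ; (inside ∷ J) QJ → contradiction QJ (¬Q₁ J) })
  ... | inj₁ ¬Q₀ | inj₂ (I₁ , Q₁ , max₁) =
    inj₂ (inside ∷ I₁ , Q₁ , λ { (outside ∷ J) QJ → contradiction QJ (¬Q₀ J) ; (inside ∷ J) QJ → s≤s (max₁ J QJ) })
  ... | inj₂ (I₀ , Q₀ , max₀) | inj₂ (I₁ , Q₁ , max₁) with ∣ I₀ ∣ ℕ.≤? suc ∣ I₁ ∣
  ...   | yes I₀≤ = inj₂ (inside ∷ I₁ , Q₁ ,
            λ { (outside ∷ J) QJ → ℕₚ.≤-trans (max₀ J QJ) I₀≤ ; (inside ∷ J) QJ → s≤s (max₁ J QJ) })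
  ...   | no I₀≰ = inj₂ (outside ∷ I₀ , Q₀ ,
            λ { (outside ∷ J) QJ → max₀ J QJ
              ; (inside ∷ J) QJ → ℕₚ.≤-trans (s≤s (max₁ J QJ)) (ℕₚ.<⇒≤ (ℕₚ.≰⇒> I₀≰)) })

  m+i≡n+j∧n≤m⇒i≤j : ∀ {m n i j} → m + i ≡ n + j → n ≤ m → i ≤ j
  m+i≡n+j∧n≤m⇒i≤j {m} {n} {i} {j} eq n≤m =
    ℕₚ.+-cancelˡ-≤ n i j (ℕₚ.≤-trans (ℕₚ.+-monoˡ-≤ i n≤m) (ℕₚ.≤-reflexive eq))

open SubsetLemmas

glueAt : ∀ {n N} (ι : Fin n → Fin N) → Subset n → Subset N → ∀ p → Dec (∃[ a ] ι a ≡ p) → Bool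
glueAt ι A X p (yes (a , _)) = lookup A a
glueAt ι A X p (no _) = lookup X p

glue : ∀ {n N} → (Fin n → Fin N) → Subset n → Subset N → Subset N
glue ι A X = tabulate λ p → glueAt ι A X p (Finₚ.any? λ a → ι a Finₚ.≟ p)

module _ {n N : ℕ} {ι : Fin n → Fin N} (ι-inj : ∀ a b → ι a ≡ ι b → a ≡ b) (A : Subset n) (X : Subset N) where

  lookup-glue-image : ∀ a → lookup (glue ι A X) (ι a) ≡ lookup A a
  lookup-glue-image a = trans (Vecₚ.lookup∘tabulate _ (ι a)) (pick (Finₚ.any? λ b → ι b Finₚ.≟ ι a))
    where
    pick : (d : Dec (∃[ b ] ι b ≡ ι a)) → glueAt ι A X (ι a) d ≡ lookup A a
    pick (yes (b , ιb≡ιa)) = cong (lookup A) (ι-inj b a ιb≡ιa)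
    pick (no ∄) = contradiction (a , refl) ∄

  lookup-glue-off : ∀ p → (∀ a → ι a ≢ p) → lookup (glue ι A X) p ≡ lookup X p
  lookup-glue-off p off = trans (Vecₚ.lookup∘tabulate _ p) (pick (Finₚ.any? λ b → ι b Finₚ.≟ p))
    where
    pick : (d : Dec (∃[ b ] ι b ≡ p)) → glueAt ι A X p d ≡ lookup X p
    pick (yes (b , ιb≡p)) = contradiction ιb≡p (off b)
    pick (no _) = refl

-- Over F defines restrict, although restrict does not involve F.
module Restriction {c ℓ : Level} {q : ℕ} (F : FiniteField c ℓ q) where
  open import Data.Nat.Base using (_+_)
  open import Algebra.Properties.CommutativeSemigroup ℕₚ.+-commutativeSemigroup
    using (x∙yz≈y∙xz; x∙yz≈yx∙z)
  open Over F using (restrict)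

  module _ {n N : ℕ} (ι : Fin n → Fin N) where

    lookup-restrict : ∀ (p : Subset N) a → lookup (restrict ι p) a ≡ lookup p (ι a)
    lookup-restrict p = Vecₚ.lookup∘tabulate (lookup p ∘ ι)

    ∈-restrict⁺ : ∀ {p : Subset N} {a} → ι a ∈ p → a ∈ restrict ι p
    ∈-restrict⁺ {p} {a} ιa∈p = lookup⇒∈ (trans (lookup-restrict p a) (∈⇒lookup ιa∈p))

    ∈-restrict⁻ : ∀ {p : Subset N} {a} → a ∈ restrict ι p → ι a ∈ p
    ∈-restrict⁻ {p} {a} a∈ = lookup⇒∈ (trans (sym (lookup-restrict p a)) (∈⇒lookup a∈))

    restrict-∁ : ∀ (p : Subset N) → restrict ι (∁ p) ≡ ∁ (restrict ι p)
    restrict-∁ p = trans (Vecₚ.tabulate-cong λ a → Vecₚ.lookup-map (ι a) not p)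
                         (Vecₚ.tabulate-∘ not (lookup p ∘ ι))

    restrict-glue : (∀ a b → ι a ≡ ι b → a ≡ b) → ∀ A (X : Subset N) → restrict ι (glue ι A X) ≡ A
    restrict-glue ι-inj A X =
      trans (Vecₚ.tabulate-cong (lookup-glue-image ι-inj A X)) (Vecₚ.tabulate∘lookup A)

    glue-⊆ : ∀ {A} {X : Subset N} → A ⊆ restrict ι X → glue ι A X ⊆ X
    glue-⊆ {A} {X} A⊆ {p} p∈ =
      lookup⇒∈ (pick (Finₚ.any? λ b → ι b Finₚ.≟ p) (trans (sym (Vecₚ.lookup∘tabulate _ p)) (∈⇒lookup p∈)))
      where
      pick : (d : Dec (∃[ b ] ι b ≡ p)) → glueAt ι A X p d ≡ true → lookup X p ≡ true
      pick (yes (b , refl)) A[b] = ∈⇒lookup (∈-restrict⁻ {p = X} (A⊆ (lookup⇒∈ A[b])))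
      pick (no _) X[p] = X[p]

  ∣Y∣+∣Z∣ι≡∣Z∣+∣Y∣ι : ∀ {n N} (ι : Fin n → Fin N) → (∀ a b → ι a ≡ ι b → a ≡ b) →
    ∀ {Y Z : Subset N} → (∀ p → (∀ a → ι a ≢ p) → lookup Y p ≡ lookup Z p) →
    ∣ Y ∣ + ∣ restrict ι Z ∣ ≡ ∣ Z ∣ + ∣ restrict ι Y ∣
  ∣Y∣+∣Z∣ι≡∣Z∣+∣Y∣ι {zero} ι _ {Y} {Z} agree = cong (_+ 0) (cong ∣_∣ Y≡Z)
    where
    Y≡Z : Y ≡ Z
    Y≡Z = trans (sym (Vecₚ.tabulate∘lookup Y))
            (trans (Vecₚ.tabulate-cong λ p → agree p λ ()) (Vecₚ.tabulate∘lookup Z))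
  ∣Y∣+∣Z∣ι≡∣Z∣+∣Y∣ι {suc n} ι ι-inj {Y} {Z} agree = begin
    ∣ Y ∣ + ∣ restrict ι Z ∣                 ≡⟨ cong (∣ Y ∣ +_) (∣b∷p∣≡∣b∷[]∣+∣p∣ z (restrict ι′ Z)) ⟩
    ∣ Y ∣ + (∣ z ∷ [] ∣ + ∣ restrict ι′ Z ∣)   ≡⟨ x∙yz≈yx∙z (∣ Y ∣) (∣ z ∷ [] ∣) (∣ restrict ι′ Z ∣) ⟩
    (∣ z ∷ [] ∣ + ∣ Y ∣) + ∣ restrict ι′ Z ∣   ≡⟨ cong (_+ ∣ restrict ι′ Z ∣) (sym (∣b∷p∣≡∣b∷[]∣+∣p∣ z Y)) ⟩
    ∣ z ∷ Y ∣ + ∣ restrict ι′ Z ∣              ≡⟨ cong (_+ ∣ restrict ι′ Z ∣) (sym (∣p[x]∷p[x]≔b∣≡∣b∷p∣ Y x₀ z)) ⟩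
    ∣ y ∷ Y′ ∣ + ∣ restrict ι′ Z ∣             ≡⟨ cong (_+ ∣ restrict ι′ Z ∣) (∣b∷p∣≡∣b∷[]∣+∣p∣ y Y′) ⟩
    (∣ y ∷ [] ∣ + ∣ Y′ ∣) + ∣ restrict ι′ Z ∣  ≡⟨ ℕₚ.+-assoc (∣ y ∷ [] ∣) (∣ Y′ ∣) (∣ restrict ι′ Z ∣) ⟩
    ∣ y ∷ [] ∣ + (∣ Y′ ∣ + ∣ restrict ι′ Z ∣)  ≡⟨ cong (∣ y ∷ [] ∣ +_) IH ⟩
    ∣ y ∷ [] ∣ + (∣ Z ∣ + ∣ restrict ι′ Y ∣)   ≡⟨ x∙yz≈y∙xz (∣ y ∷ [] ∣) (∣ Z ∣) (∣ restrict ι′ Y ∣) ⟩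
    ∣ Z ∣ + (∣ y ∷ [] ∣ + ∣ restrict ι′ Y ∣)   ≡⟨ cong (∣ Z ∣ +_) (sym (∣b∷p∣≡∣b∷[]∣+∣p∣ y (restrict ι′ Y))) ⟩
    ∣ Z ∣ + ∣ restrict ι Y ∣                 ∎
    where
    open ≡.≡-Reasoning
    ι′ = ι ∘ suc
    x₀ = ι zero
    y = lookup Y x₀
    z = lookup Z x₀
    Y′ = Y Vec.[ x₀ ]≔ z
    ι′a≢x₀ : ∀ a → ι′ a ≢ x₀
    ι′a≢x₀ a eq with ι-inj (suc a) zero eq
    ... | ()
    agree′ : ∀ p → (∀ a → ι′ a ≢ p) → lookup Y′ p ≡ lookup Z p
    agree′ p off with p Finₚ.≟ x₀
    ... | yes refl = Vecₚ.lookup∘update x₀ Y z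
    ... | no p≢x₀ = trans (Vecₚ.lookup∘update′ p≢x₀ Y z)
                          (agree p λ { zero → p≢x₀ ∘ sym ; (suc a) → off a })
    IH : ∣ Y′ ∣ + ∣ restrict ι′ Z ∣ ≡ ∣ Z ∣ + ∣ restrict ι′ Y ∣
    IH = trans (∣Y∣+∣Z∣ι≡∣Z∣+∣Y∣ι ι′ (λ a b eq → Finₚ.suc-injective (ι-inj (suc a) (suc b) eq)) {Y′} {Z} agree′)
               (cong (λ W → ∣ Z ∣ + ∣ W ∣) (Vecₚ.tabulate-cong λ a → Vecₚ.lookup∘update′ (ι′a≢x₀ a) Y z))

module LinearAlgebra {c ℓ : Level} {q : ℕ} (F : FiniteField c ℓ q) where
  open FiniteField F hiding (zero; refl; sym; trans; _-_)
  open FiniteField F using () renaming (refl to ≈-refl; sym to ≈-sym; trans to ≈-trans)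
  open Over F
  open import Algebra.Properties.Semiring.Sum semiring
    using (sum; ∑-distrib-+; *-distribˡ-sum; sum-remove; sum-cong-≋; sum-replicate-zero)
  open import Algebra.Properties.Ring ring using (-0#≈0#; -‿injective)
  open import Relation.Binary.Reasoning.Setoid setoid
  infix 4 _≈?_
  _≈?_ : ∀ x y → Dec (x ≈ y)
  x ≈? y with enum-surj x | enum-surj y
  ... | i , i↦x | j , j↦y =
    Dec.map′ (λ { refl → ≈-trans (≈-sym i↦x) j↦y })
             (λ x≈y → enum-inj i j (≈-trans i↦x (≈-trans x≈y (≈-sym j↦y))))
             (i Finₚ.≟ j)

  x+-x*1≈0 : ∀ x → x + (- x) * 1# ≈ 0#
  x+-x*1≈0 x = ≈-trans (+-congˡ (*-identityʳ (- x))) (-‿inverseʳ x)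

  x≈0⇒x+-x*y≈0 : ∀ {x} y → x ≈ 0# → x + (- x) * y ≈ 0#
  x≈0⇒x+-x*y≈0 {x} y x≈0 = begin
    x + (- x) * y   ≈⟨ +-cong x≈0 (*-congʳ (-‿cong x≈0)) ⟩
    0# + (- 0#) * y ≈⟨ +-identityˡ _ ⟩
    (- 0#) * y      ≈⟨ *-congʳ -0#≈0# ⟩
    0# * y          ≈⟨ zeroˡ y ⟩
    0#              ∎

  x≈[x+-y*z]+y*z : ∀ x y z → x ≈ (x + (- y) * z) + y * z
  x≈[x+-y*z]+y*z x y z = ≈-sym (begin
    (x + (- y) * z) + y * z ≈⟨ +-assoc x _ _ ⟩
    x + ((- y) * z + y * z) ≈⟨ +-congˡ (distribʳ z (- y) y) ⟨
    x + (- y + y) * z       ≈⟨ +-congˡ (*-congʳ (-‿inverseˡ y)) ⟩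
    x + 0# * z              ≈⟨ +-congˡ (zeroˡ z) ⟩
    x + 0#                  ≈⟨ +-identityʳ x ⟩
    x                       ∎)

  x≉0∧x*y≈0⇒y≈0 : ∀ {x y} → ¬ x ≈ 0# → x * y ≈ 0# → y ≈ 0#
  x≉0∧x*y≈0⇒y≈0 {x} {y} x≉0 xy≈0 with inverse x x≉0
  ... | x⁻¹ , xx⁻¹≈1 = begin
    y                ≈⟨ *-identityˡ y ⟨
    1# * y           ≈⟨ *-congʳ (≈-trans (≈-sym xx⁻¹≈1) (*-comm x x⁻¹)) ⟩
    (x⁻¹ * x) * y    ≈⟨ *-assoc x⁻¹ x y ⟩
    x⁻¹ * (x * y)    ≈⟨ *-congˡ xy≈0 ⟩
    x⁻¹ * 0#         ≈⟨ zeroʳ x⁻¹ ⟩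
    0#               ∎

  sumFin≡sum : ∀ {n} (f : Fin n → Carrier) → sumFin f ≡ sum f
  sumFin≡sum {zero} f = refl
  sumFin≡sum {suc n} f = cong (f zero +_) (sumFin≡sum (f ∘ suc))

  sumFin-cong : ∀ {n} {f g : Fin n → Carrier} → (∀ i → f i ≈ g i) → sumFin f ≈ sumFin g
  sumFin-cong {f = f} {g} f≈g = begin
    sumFin f ≡⟨ sumFin≡sum f ⟩
    sum f    ≈⟨ sum-cong-≋ f≈g ⟩
    sum g    ≡⟨ sumFin≡sum g ⟨
    sumFin g ∎

  sumFin-zero : ∀ {n} {f : Fin n → Carrier} → (∀ i → f i ≈ 0#) → sumFin f ≈ 0#
  sumFin-zero {n} f≈0 =
    ≈-trans (sumFin-cong f≈0) (≈-trans (reflexive (sumFin≡sum {n} λ _ → 0#)) (sum-replicate-zero n))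

  sumFin-+ : ∀ {n} (f g : Fin n → Carrier) → sumFin (λ i → f i + g i) ≈ sumFin f + sumFin g
  sumFin-+ f g = begin
    sumFin (λ i → f i + g i) ≡⟨ sumFin≡sum (λ i → f i + g i) ⟩
    sum (λ i → f i + g i)    ≈⟨ ∑-distrib-+ f g ⟩
    sum f + sum g            ≡⟨ cong₂ _+_ (sumFin≡sum f) (sumFin≡sum g) ⟨
    sumFin f + sumFin g      ∎

  *-distribˡ-sumFin : ∀ {n} x (f : Fin n → Carrier) → x * sumFin f ≈ sumFin (λ i → x * f i)
  *-distribˡ-sumFin x f = begin
    x * sumFin f            ≡⟨ cong (x *_) (sumFin≡sum f) ⟩
    x * sum f               ≈⟨ *-distribˡ-sum x f ⟩
    sum (λ i → x * f i)     ≡⟨ sumFin≡sum (λ i → x * f i) ⟨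
    sumFin (λ i → x * f i)  ∎

  sumFin-single : ∀ {n} (x : Fin n) (f : Fin n → Carrier) → (∀ i → i ≢ x → f i ≈ 0#) → sumFin f ≈ f x
  sumFin-single {suc n} x f off = begin
    sumFin f                        ≡⟨ sumFin≡sum f ⟩
    sum f                           ≈⟨ sum-remove {i = x} f ⟩
    f x + sum (λ j → f (punchIn x j)) ≈⟨ +-congˡ rest≈0 ⟩
    f x + 0#                        ≈⟨ +-identityʳ (f x) ⟩
    f x                             ∎
    where
    rest≈0 : sum (λ j → f (punchIn x j)) ≈ 0#
    rest≈0 = ≈-trans (reflexive (sym (sumFin≡sum λ j → f (punchIn x j))))
                     (sumFin-zero λ j → off (punchIn x j) (Finₚ.punchInᵢ≢i x j))

  sumFin≉0⇒∃f≉0 : ∀ {n} (f : Fin n → Carrier) → ¬ sumFin f ≈ 0# → ∃[ i ] ¬ f i ≈ 0#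
  sumFin≉0⇒∃f≉0 {n} f sum≉0 =
    Finₚ.¬∀⟶∃¬ n _ (λ i → f i ≈? 0#) (sum≉0 ∘ sumFin-zero)

  Ker : ∀ {n r} → (Fin r → Fin n → Carrier) → Vector n → Set ℓ
  Ker H a = ∀ row → sumFin (λ e → a e * H row e) ≈ 0#

  SuppIn : ∀ {n} → Vector n → Subset n → Set ℓ
  SuppIn a I = ∀ e → e ∉ I → a e ≈ 0#

  module _ {n r : ℕ} (H : Fin r → Fin n → Carrier) where

    Ker-cong : ∀ {a b : Vector n} → (∀ e → a e ≈ b e) → Ker H a → Ker H b
    Ker-cong a≈b ka row = ≈-trans (sumFin-cong λ e → *-congʳ (≈-sym (a≈b e))) (ka row)

    Ker-zero : Ker H (λ _ → 0#)
    Ker-zero row = sumFin-zero λ e → zeroˡ (H row e)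

    Ker-+ : ∀ {a b : Vector n} → Ker H a → Ker H b → Ker H (λ e → a e + b e)
    Ker-+ {a} {b} ka kb row = begin
      sumFin (λ e → (a e + b e) * H row e)                ≈⟨ sumFin-cong (λ e → distribʳ (H row e) (a e) (b e)) ⟩
      sumFin (λ e → a e * H row e + b e * H row e)        ≈⟨ sumFin-+ (λ e → a e * H row e) (λ e → b e * H row e) ⟩
      sumFin (λ e → a e * H row e) + sumFin (λ e → b e * H row e) ≈⟨ +-cong (ka row) (kb row) ⟩
      0# + 0#                                             ≈⟨ +-identityʳ 0# ⟩
      0#                                                  ∎

    Ker-* : ∀ x {a : Vector n} → Ker H a → Ker H (λ e → x * a e)
    Ker-* x {a} ka row = begin
      sumFin (λ e → (x * a e) * H row e)  ≈⟨ sumFin-cong (λ e → *-assoc x (a e) (H row e)) ⟩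
      sumFin (λ e → x * (a e * H row e))  ≈⟨ *-distribˡ-sumFin x (λ e → a e * H row e) ⟨
      x * sumFin (λ e → a e * H row e)    ≈⟨ *-congˡ (ka row) ⟩
      x * 0#                              ≈⟨ zeroʳ x ⟩
      0#                                  ∎

    Ker-∑ : ∀ {m} (x : Fin m → Carrier) (b : Fin m → Vector n) → (∀ g → Ker H (b g)) →
      Ker H (λ e → sumFin (λ g → x g * b g e))
    Ker-∑ {zero} x b kb = Ker-zero
    Ker-∑ {suc m} x b kb = Ker-+ (Ker-* (x zero) (kb zero)) (Ker-∑ (x ∘ suc) (b ∘ suc) (kb ∘ suc))

    parityCheck⇒Ker : ∀ {C : Code n} → IsParityCheck C H → ∀ {a} → C a → Ker H a
    parityCheck⇒Ker pc {a} Ca row =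
      ≈-trans (sumFin-cong λ e → *-comm (a e) (H row e)) (proj₂ (pc a) Ca row)

    Ker⇒parityCheck : ∀ {C : Code n} → IsParityCheck C H → ∀ {a} → Ker H a → C a
    Ker⇒parityCheck pc {a} ka =
      proj₁ (pc a) λ row → ≈-trans (sumFin-cong λ e → *-comm (H row e) (a e)) (ka row)

    Ker? : ∀ a → Dec (Ker H a)
    Ker? a = Finₚ.all? λ row → sumFin (λ e → a e * H row e) ≈? 0#

  SuppIn? : ∀ {n} (a : Vector n) I → Dec (SuppIn a I)
  SuppIn? a I = Finₚ.all? λ e → ¬? (e ∈? I) →-dec (a e ≈? 0#)

  SuppIn-cong : ∀ {n} {a b : Vector n} {I} → (∀ e → a e ≈ b e) → SuppIn a I → SuppIn b I
  SuppIn-cong a≈b sa e e∉I = ≈-trans (≈-sym (a≈b e)) (sa e e∉I)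

  any?-Vec : ∀ {p} n {P : Vec (Fin q) n → Set p} → (∀ v → Dec (P v)) → Dec (∃ P)
  any?-Vec zero P? = Dec.map′ ([] ,_) (λ { ([] , P[]) → P[] }) (P? [])
  any?-Vec (suc n) P? =
    Dec.map′ (λ (x , v , Pxv) → x ∷ v , Pxv) (λ { (x ∷ v , Pxv) → x , v , Pxv })
             (Finₚ.any? λ x → any?-Vec n (P? ∘ (x ∷_)))

  -- Vectors over F are searched through their coordinates in the enumeration of F.
  any?-Vector : ∀ {p n} {P : Vector n → Set p} → (∀ {a b} → (∀ e → a e ≈ b e) → P a → P b) →
    (∀ a → Dec (P a)) → Dec (∃ P)
  any?-Vector {n = n} {P} P-cong P? =
    Dec.map′ (λ (v , Pv) → enum ∘ lookup v , Pv) found (any?-Vec n (P? ∘ (λ v → enum ∘ lookup v)))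
    where
    found : ∃ P → ∃[ v ] P (enum ∘ lookup v)
    found (a , Pa) = code , P-cong decode Pa
      where
      code = tabulate (proj₁ ∘ enum-surj ∘ a)
      decode : ∀ e → a e ≈ enum (lookup code e)
      decode e = ≈-sym (≈-trans (reflexive (cong enum (Vecₚ.lookup∘tabulate _ e))) (proj₂ (enum-surj (a e))))

  module _ {n r : ℕ} (H : Fin r → Fin n → Carrier) where

    indep-or-dependent : ∀ I → IndepCols H I ⊎ ∃[ a ] (SuppIn a I × Ker H a × ∃[ e ] ¬ a e ≈ 0#)
    indep-or-dependent I with any?-Vector dependency-cong dependency?
      where
      dependency-cong : ∀ {a b} → (∀ e → a e ≈ b e) →
        SuppIn a I × Ker H a × ∃[ e ] ¬ a e ≈ 0# → SuppIn b I × Ker H b × ∃[ e ] ¬ b e ≈ 0#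
      dependency-cong a≈b (sa , ka , e , ae≉0) =
        SuppIn-cong a≈b sa , Ker-cong H a≈b ka , e , λ be≈0 → ae≉0 (≈-trans (a≈b e) be≈0)
      dependency? : ∀ a → Dec (SuppIn a I × Ker H a × ∃[ e ] ¬ a e ≈ 0#)
      dependency? a = SuppIn? a I ×-dec Ker? H a ×-dec Finₚ.any? (λ e → ¬? (a e ≈? 0#))
    ... | yes dependency = inj₂ dependency
    ... | no ∄dependency = inj₁ λ a sa ka e →
      Dec.decidable-stable (a e ≈? 0#) λ ae≉0 → ∄dependency (a , sa , ka , e , ae≉0)

    IndepCols? : ∀ I → Dec (IndepCols H I)
    IndepCols? I with indep-or-dependent I
    ... | inj₁ indep = yes indep
    ... | inj₂ (a , sa , ka , e , ae≉0) = no λ indep → ae≉0 (indep a sa ka e)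

    IndepCols-⊆ : ∀ {I J} → J ⊆ I → IndepCols H I → IndepCols H J
    IndepCols-⊆ J⊆I indep a sa = indep a λ e e∉I → sa e (e∉I ∘ J⊆I)

    OnCycle : Subset n → Fin n → Set (c ⊔ ℓ)
    OnCycle τ x = ∃[ a ] (Ker H a × SuppIn a τ × ¬ a x ≈ 0#)

    OnCycle? : ∀ τ x → Dec (OnCycle τ x)
    OnCycle? τ x = any?-Vector
      (λ a≈b (ka , sa , ax≉0) → Ker-cong H a≈b ka , SuppIn-cong a≈b sa , λ bx≈0 → ax≉0 (≈-trans (a≈b x) bx≈0))
      (λ a → Ker? H a ×-dec SuppIn? a τ ×-dec ¬? (a x ≈? 0#))

    fundamental-circuit : ∀ {I g} → IndepCols H I → ¬ IndepCols H (I ∪ ⁅ g ⁆) →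
      ∃[ b ] (Ker H b × SuppIn b (I ∪ ⁅ g ⁆) × b g ≈ 1#)
    fundamental-circuit {I} {g} indep dep with indep-or-dependent (I ∪ ⁅ g ⁆)
    ... | inj₁ indep′ = contradiction indep′ dep
    ... | inj₂ (a , sa , ka , e , ae≉0) with inverse (a g) ag≉0
      where
      ag≉0 : ¬ a g ≈ 0#
      ag≉0 ag≈0 = ae≉0 (indep a sa′ ka e)
        where
        sa′ : SuppIn a I
        sa′ x x∉I with x Finₚ.≟ g
        ... | yes refl = ag≈0
        ... | no x≢g = sa x λ x∈ → [ x∉I , x≢g ∘ x∈⁅y⁆⇒x≡y g ]′ (x∈p∪q⁻ I ⁅ g ⁆ x∈)
    ... | a⁻¹ , aa⁻¹≈1 =
      (λ x → a⁻¹ * a x) , Ker-* H a⁻¹ ka , (λ x x∉ → ≈-trans (*-congˡ (sa x x∉)) (zeroʳ a⁻¹)) ,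
      ≈-trans (*-comm a⁻¹ (a g)) aa⁻¹≈1

    record FundamentalCircuits (τ I : Subset n) : Set (c ⊔ ℓ) where
      field
        circuit   : Fin n → Vector n
        ker       : ∀ g → Ker H (circuit g)
        supp      : ∀ g → SuppIn (circuit g) (I ∪ ⁅ g ⁆)
        pivot     : ∀ g → g ∈ τ → g ∉ I → circuit g g ≈ 1#
        vanishing : ∀ g → ¬ (g ∈ τ × g ∉ I) → ∀ x → circuit g x ≈ 0#

    -- a = ∑_g a_g C_g, written without subtraction.
    circuit-expansion : ∀ {τ I} → IndepCols H I → (C : FundamentalCircuits τ I) →
      ∀ {a} → Ker H a → SuppIn a τ →
      ∀ x → a x + sumFin (λ g → (- a g) * FundamentalCircuits.circuit C g x) ≈ 0#
    circuit-expansion {τ} {I} indep C {a} ka sa = indep a′ sa′ ka′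
      where
      open FundamentalCircuits C
      a′ : Vector n
      a′ x = a x + sumFin (λ g → (- a g) * circuit g x)
      ka′ : Ker H a′
      ka′ = Ker-+ H ka (Ker-∑ H (λ g → - a g) circuit ker)
      sa′ : SuppIn a′ I
      sa′ x x∉I = ≈-trans (+-congˡ (sumFin-single x _ off-x)) (on-x (x ∈? τ))
        where
        off-x : ∀ g → g ≢ x → (- a g) * circuit g x ≈ 0#
        off-x g g≢x = ≈-trans (*-congˡ (supp g x λ x∈ → [ x∉I , g≢x ∘ sym ∘ x∈⁅y⁆⇒x≡y g ]′ (x∈p∪q⁻ I ⁅ g ⁆ x∈)))
                              (zeroʳ (- a g))
        on-x : Dec (x ∈ τ) → a x + (- a x) * circuit x x ≈ 0#
        on-x (yes x∈τ) = ≈-trans (+-congˡ (*-congˡ (pivot x x∈τ x∉I))) (x+-x*1≈0 (a x))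
        on-x (no x∉τ)  = x≈0⇒x+-x*y≈0 (circuit x x) (sa x x∉τ)

    exchange-indep : ∀ {I e g b} → IndepCols H I → e ∈ I → g ∉ I →
      Ker H b → SuppIn b (I ∪ ⁅ g ⁆) → b g ≈ 1# → ¬ b e ≈ 0# → IndepCols H ((I - e) ∪ ⁅ g ⁆)
    exchange-indep {I} {e} {g} {b} indep e∈I g∉I kb sb bg≈1 be≉0 v sv kv x = begin
      v x                             ≈⟨ x≈[x+-y*z]+y*z (v x) (v g) (b x) ⟩
      (v x + (- v g) * b x) + v g * b x ≈⟨ +-cong (w≈0 x) (*-congʳ vg≈0) ⟩
      0# + 0# * b x                   ≈⟨ +-identityˡ _ ⟩
      0# * b x                        ≈⟨ zeroˡ (b x) ⟩
      0#                              ∎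
      where
      w : Vector n
      w y = v y + (- v g) * b y
      sw : SuppIn w I
      sw y y∉I with y Finₚ.≟ g
      ... | yes refl = ≈-trans (+-congˡ (*-congˡ bg≈1)) (x+-x*1≈0 (v g))
      ... | no y≢g = begin
        v y + (- v g) * b y ≈⟨ +-cong (sv y y∉I′) (*-congˡ (sb y y∉I∪g)) ⟩
        0# + (- v g) * 0#   ≈⟨ +-identityˡ _ ⟩
        (- v g) * 0#        ≈⟨ zeroʳ _ ⟩
        0#                  ∎
        where
        y∉I′ : y ∉ (I - e) ∪ ⁅ g ⁆
        y∉I′ y∈ = [ y∉I ∘ p─q⊆p I ⁅ e ⁆ , y≢g ∘ x∈⁅y⁆⇒x≡y g ]′ (x∈p∪q⁻ (I - e) ⁅ g ⁆ y∈)
        y∉I∪g : y ∉ I ∪ ⁅ g ⁆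
        y∉I∪g y∈ = [ y∉I , y≢g ∘ x∈⁅y⁆⇒x≡y g ]′ (x∈p∪q⁻ I ⁅ g ⁆ y∈)
      w≈0 : ∀ y → w y ≈ 0#
      w≈0 = indep w sw (Ker-+ H kv (Ker-* H (- v g) kb))
      ve≈0 : v e ≈ 0#
      ve≈0 = sv e λ e∈ → [ x∉p-x I e , (λ e∈g → g∉I (subst (_∈ I) (x∈⁅y⁆⇒x≡y g e∈g) e∈I)) ]′
                                (x∈p∪q⁻ (I - e) ⁅ g ⁆ e∈)
      vg≈0 : v g ≈ 0#
      vg≈0 = -‿injective (≈-trans (x≉0∧x*y≈0⇒y≈0 be≉0 be*-vg≈0) (≈-sym -0#≈0#))
        where
        be*-vg≈0 : b e * (- v g) ≈ 0#
        be*-vg≈0 = begin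
          b e * (- v g)         ≈⟨ *-comm (b e) (- v g) ⟩
          (- v g) * b e         ≈⟨ +-identityˡ _ ⟨
          0# + (- v g) * b e    ≈⟨ +-congʳ ve≈0 ⟨
          v e + (- v g) * b e   ≈⟨ w≈0 e ⟩
          0#                    ∎

module ParityCheckMatroid {c ℓ : Level} {q : ℕ} (F : FiniteField c ℓ q) where
  open FiniteField F using (Carrier; _≈_; 0#; 1#; _*_; -_; zeroʳ; *-congˡ; +-congˡ; +-identityʳ)
    renaming (refl to ≈-refl; sym to ≈-sym; trans to ≈-trans)
  open Over F
  open LinearAlgebra F
  open Restriction F
  open import Data.Nat.Base using (_+_; _∸_)
  open import Algebra.Properties.CommutativeSemigroup ℕₚ.+-commutativeSemigroup using (xy∙z≈xz∙y)

  module _ {n r : ℕ} (H : Fin r → Fin n → Carrier) where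

    IsBasis : Subset n → Subset n → Set (c ⊔ ℓ)
    IsBasis τ I = I ⊆ τ × IndepCols H I × (∀ J → J ⊆ τ → IndepCols H J → ∣ J ∣ ≤ ∣ I ∣)

    basis-exists : ∀ τ → ∃ (IsBasis τ)
    basis-exists τ with largest n (λ I → I ⊆ τ × IndepCols H I) (λ I → (I ⊆? τ) ×-dec IndepCols? H I)
    ... | inj₁ none = ⊥-elim (none ⊥ (⊆-min τ , λ a sa _ e → sa e ∉⊥))
    ... | inj₂ (I , (I⊆τ , indep) , max) = I , I⊆τ , indep , λ J J⊆τ indepJ → max J (J⊆τ , indepJ)

    basis⇒rank : ∀ {τ I} → IsBasis τ I → IsRank H τ ∣ I ∣
    basis⇒rank (I⊆τ , indep , max) = (_ , I⊆τ , indep , refl) , max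

    rank-unique : ∀ {τ k k′} → IsRank H τ k → IsRank H τ k′ → k ≡ k′
    rank-unique ((I , I⊆ , indep , refl) , max) ((I′ , I′⊆ , indep′ , refl) , max′) =
      ℕₚ.≤-antisym (max′ I I⊆ indep) (max I′ I′⊆ indep′)

    basis⇒nullity : ∀ {τ I} → IsBasis τ I → HasNullity H τ (∣ τ ∣ ∸ ∣ I ∣)
    basis⇒nullity {I = I} basis@(I⊆τ , _) =
      ∣ I ∣ , basis⇒rank basis , sym (ℕₚ.m+[n∸m]≡n (p⊆q⇒∣p∣≤∣q∣ I⊆τ))

    basis-∪-dependent : ∀ {τ I g} → IsBasis τ I → g ∈ τ → g ∉ I → ¬ IndepCols H (I ∪ ⁅ g ⁆)
    basis-∪-dependent {τ} {I} {g} (I⊆τ , _ , max) g∈τ g∉I indep =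
      ℕₚ.<-irrefl refl (ℕₚ.≤-trans (ℕₚ.≤-reflexive (sym (x∉p⇒∣p∪⁅x⁆∣≡1+∣p∣ g∉I))) (max _ I∪g⊆τ indep))
      where
      I∪g⊆τ : I ∪ ⁅ g ⁆ ⊆ τ
      I∪g⊆τ y∈ = [ I⊆τ , (λ y∈g → subst (_∈ τ) (sym (x∈⁅y⁆⇒x≡y g y∈g)) g∈τ) ]′ (x∈p∪q⁻ I ⁅ g ⁆ y∈)

    fundamentalCircuits : ∀ {τ I} → IsBasis τ I → FundamentalCircuits H τ I
    fundamentalCircuits {τ} {I} basis@(_ , indep , _) = record
      { circuit   = proj₁ ∘ choice
      ; ker       = proj₁ ∘ proj₂ ∘ choice
      ; supp      = proj₁ ∘ proj₂ ∘ proj₂ ∘ choice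
      ; pivot     = proj₁ ∘ proj₂ ∘ proj₂ ∘ proj₂ ∘ choice
      ; vanishing = proj₂ ∘ proj₂ ∘ proj₂ ∘ proj₂ ∘ choice
      }
      where
      choice : ∀ g → ∃[ b ] (Ker H b × SuppIn b (I ∪ ⁅ g ⁆) × (g ∈ τ → g ∉ I → b g ≈ 1#) ×
                             (¬ (g ∈ τ × g ∉ I) → ∀ x → b x ≈ 0#))
      choice g with (g ∈? τ) ×-dec ¬? (g ∈? I)
      ... | yes (g∈τ , g∉I) with fundamental-circuit H indep (basis-∪-dependent basis g∈τ g∉I)
      ...   | b , kb , sb , bg≈1 = b , kb , sb , (λ _ _ → bg≈1) , λ off → contradiction (g∈τ , g∉I) off
      choice g | no off =
        (λ _ → 0#) , Ker-zero H , (λ _ _ → ≈-refl) ,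
        (λ g∈τ g∉I → contradiction (g∈τ , g∉I) off) , λ _ _ → ≈-refl

    module _ {τ I} (basis : IsBasis τ I) where
      open FundamentalCircuits (fundamentalCircuits basis)

      cycle-meets-fundamental-circuit : ∀ {x} → OnCycle H τ x →
        ∃[ g ] (g ∈ τ × g ∉ I × ¬ circuit g x ≈ 0#)
      cycle-meets-fundamental-circuit {x} (a , ka , sa , ax≉0)
        with sumFin≉0⇒∃f≉0 (λ g → (- a g) * circuit g x) ∑≉0
        where
        ∑≉0 : ¬ sumFin (λ g → (- a g) * circuit g x) ≈ 0#
        ∑≉0 ∑≈0 = ax≉0 (≈-trans (≈-sym (≈-trans (+-congˡ ∑≈0) (+-identityʳ (a x))))
                              (circuit-expansion H (proj₁ (proj₂ basis)) (fundamentalCircuits basis) ka sa x))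
      ... | g , term≉0 = g , map₂ (_, Cgx≉0) g∈τ∖I
        where
        Cgx≉0 : ¬ circuit g x ≈ 0#
        Cgx≉0 Cgx≈0 = term≉0 (≈-trans (*-congˡ Cgx≈0) (zeroʳ (- a g)))
        g∈τ∖I : g ∈ τ × g ∉ I
        g∈τ∖I = Dec.decidable-stable ((g ∈? τ) ×-dec ¬? (g ∈? I)) λ off → Cgx≉0 (vanishing g off x)

      basis-exchange : ∀ {x} → OnCycle H τ x → ∃[ I′ ] (I′ ⊆ τ - x × IndepCols H I′ × ∣ I′ ∣ ≡ ∣ I ∣)
      basis-exchange {x} cycle with x ∈? I
      ... | no x∉I = I , (λ y∈I → x∈p∧x≢y⇒x∈p-y (I⊆τ y∈I) λ { refl → x∉I y∈I }) , indep , refl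
        where
        I⊆τ = proj₁ basis
        indep = proj₁ (proj₂ basis)
      ... | yes x∈I with cycle-meets-fundamental-circuit cycle
      ...   | g , g∈τ , g∉I , Cgx≉0 =
        (I - x) ∪ ⁅ g ⁆ , ⊆τ-x ,
        exchange-indep H (proj₁ (proj₂ basis)) x∈I g∉I (ker g) (supp g) (pivot g g∈τ g∉I) Cgx≉0 ,
        trans (x∉p⇒∣p∪⁅x⁆∣≡1+∣p∣ (g∉I ∘ p─q⊆p I ⁅ x ⁆)) (sym (x∈p⇒∣p∣≡1+∣p-x∣ x∈I))
        where
        ⊆τ-x : (I - x) ∪ ⁅ g ⁆ ⊆ τ - x
        ⊆τ-x y∈ with x∈p∪q⁻ (I - x) ⁅ g ⁆ y∈
        ... | inj₁ y∈I-x = x∈p∧x≢y⇒x∈p-y (proj₁ basis (p─q⊆p I ⁅ x ⁆ y∈I-x)) λ { refl → x∉p-x I x y∈I-x }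
        ... | inj₂ y∈g with x∈⁅y⁆⇒x≡y g y∈g
        ...   | refl = x∈p∧x≢y⇒x∈p-y g∈τ λ { refl → g∉I x∈I }

    nullity-mono : ∀ {τ′ τ j′ j} → τ′ ⊆ τ → HasNullity H τ′ j′ → HasNullity H τ j → j′ ≤ j
    nullity-mono {τ′} {τ} {j′} {j} τ′⊆τ (k′ , rk′ , ∣τ′∣≡) (_ , ((I , I⊆τ , indep , refl) , _) , ∣τ∣≡) =
      m+i≡n+j∧n≤m⇒i≤j size-τ rank-τ≤
      where
      open ≡.≡-Reasoning
      size-τ : (k′ + ∣ τ ─ τ′ ∣) + j′ ≡ ∣ I ∣ + j
      size-τ = begin
        (k′ + ∣ τ ─ τ′ ∣) + j′  ≡⟨ xy∙z≈xz∙y k′ ∣ τ ─ τ′ ∣ j′ ⟩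
        (k′ + j′) + ∣ τ ─ τ′ ∣  ≡⟨ cong (_+ ∣ τ ─ τ′ ∣) ∣τ′∣≡ ⟨
        ∣ τ′ ∣ + ∣ τ ─ τ′ ∣     ≡⟨ q⊆p⇒∣p∣≡∣q∣+∣p─q∣ τ′⊆τ ⟨
        ∣ τ ∣                   ≡⟨ ∣τ∣≡ ⟩
        ∣ I ∣ + j               ∎
      I─τ′⊆τ─τ′ : I ─ τ′ ⊆ τ ─ τ′
      I─τ′⊆τ─τ′ y∈ = x∈p∧x∉q⇒x∈p─q (I⊆τ (p─q⊆p I τ′ y∈)) (x∈p─q⇒x∉q I τ′ y∈)
      rank-τ≤ : ∣ I ∣ ≤ k′ + ∣ τ ─ τ′ ∣
      rank-τ≤ = ℕₚ.≤-trans (ℕₚ.≤-reflexive (∣p∣≡∣p∩q∣+∣p─q∣ I τ′))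
        (ℕₚ.+-mono-≤ (proj₂ rk′ (I ∩ τ′) (p∩q⊆q I τ′) (IndepCols-⊆ H (p∩q⊆p I τ′) indep))
                     (p⊆q⇒∣p∣≤∣q∣ I─τ′⊆τ─τ′))

    nullity-remove-cycle : ∀ {τ x j j′} → x ∈ τ → OnCycle H τ x →
      HasNullity H τ j → HasNullity H (τ - x) j′ → j ≡ suc j′
    nullity-remove-cycle {τ} {x} {j} {j′} x∈τ cycle
      (k , rk , ∣τ∣≡) (k′ , rk′@((J , J⊆ , indepJ , refl) , _) , ∣τ-x∣≡)
      with basis-exists τ
    ... | I , basis with basis-exchange basis cycle
    ...   | I′ , I′⊆ , indepI′ , ∣I′∣≡∣I∣ = ℕₚ.+-cancelˡ-≡ k j (suc j′) size-τ
      where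
      open ≡.≡-Reasoning
      k≡k′ : k ≡ k′
      k≡k′ = trans (rank-unique rk (basis⇒rank basis))
        (ℕₚ.≤-antisym (ℕₚ.≤-trans (ℕₚ.≤-reflexive (sym ∣I′∣≡∣I∣)) (proj₂ rk′ I′ I′⊆ indepI′))
                      (proj₂ (proj₂ basis) J (p─q⊆p τ ⁅ x ⁆ ∘ J⊆) indepJ))
      size-τ : k + j ≡ k + suc j′
      size-τ = begin
        k + j             ≡⟨ ∣τ∣≡ ⟨
        ∣ τ ∣             ≡⟨ x∈p⇒∣p∣≡1+∣p-x∣ x∈τ ⟩
        suc ∣ τ - x ∣     ≡⟨ cong suc ∣τ-x∣≡ ⟩
        suc (k′ + j′)     ≡⟨ cong (λ m → suc (m + j′)) k≡k′ ⟨
        suc (k + j′)      ≡⟨ ℕₚ.+-suc k j′ ⟨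
        k + suc j′        ∎

    nullity-remove-coloop : ∀ {τ x i} → x ∈ τ → ¬ OnCycle H τ x → HasNullity H τ i → HasNullity H (τ - x) i
    nullity-remove-coloop {τ} {x} {i} x∈τ ¬cycle (k , rk , ∣τ∣≡) with basis-exists (τ - x)
    ... | I , basis@(I⊆τ-x , indepI , maxI) = ∣ I ∣ , basis⇒rank basis , size-τ-x
      where
      x∉I : x ∉ I
      x∉I = x∉p-x τ x ∘ I⊆τ-x
      I∪x⊆τ : I ∪ ⁅ x ⁆ ⊆ τ
      I∪x⊆τ y∈ = [ p─q⊆p τ ⁅ x ⁆ ∘ I⊆τ-x , (λ y∈x → subst (_∈ τ) (sym (x∈⁅y⁆⇒x≡y x y∈x)) x∈τ) ]′
                   (x∈p∪q⁻ I ⁅ x ⁆ y∈)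
      indepI∪x : IndepCols H (I ∪ ⁅ x ⁆)
      indepI∪x v sv kv = indepI v svI kv
        where
        vx≈0 : v x ≈ 0#
        vx≈0 = Dec.decidable-stable (v x ≈? 0#) λ vx≉0 →
          ¬cycle (v , kv , (λ y y∉τ → sv y (y∉τ ∘ I∪x⊆τ)) , vx≉0)
        svI : SuppIn v I
        svI y y∉I with y Finₚ.≟ x
        ... | yes refl = vx≈0
        ... | no y≢x = sv y λ y∈ → [ y∉I , y≢x ∘ x∈⁅y⁆⇒x≡y x ]′ (x∈p∪q⁻ I ⁅ x ⁆ y∈)
      J-x⊆τ-x : ∀ {J} → J ⊆ τ → J - x ⊆ τ - x
      J-x⊆τ-x {J} J⊆τ y∈ = x∈p∧x≢y⇒x∈p-y (J⊆τ (p─q⊆p J ⁅ x ⁆ y∈)) λ { refl → x∉p-x J x y∈ }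
      rank-τ : IsRank H τ (suc ∣ I ∣)
      rank-τ = (I ∪ ⁅ x ⁆ , I∪x⊆τ , indepI∪x , x∉p⇒∣p∪⁅x⁆∣≡1+∣p∣ x∉I) ,
        λ J J⊆τ indepJ → ℕₚ.≤-trans (∣p∣≤1+∣p-x∣ J x)
                           (s≤s (maxI (J - x) (J-x⊆τ-x J⊆τ) (IndepCols-⊆ H (p─q⊆p J ⁅ x ⁆) indepJ)))
      size-τ-x : ∣ τ - x ∣ ≡ ∣ I ∣ + i
      size-τ-x = ℕₚ.suc-injective (begin
        suc ∣ τ - x ∣  ≡⟨ x∈p⇒∣p∣≡1+∣p-x∣ x∈τ ⟨
        ∣ τ ∣          ≡⟨ ∣τ∣≡ ⟩
        k + i          ≡⟨ cong (_+ i) (rank-unique rk rank-τ) ⟩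
        suc ∣ I ∣ + i  ∎)
        where open ≡.≡-Reasoning

    minimal⇒OnCycle : ∀ {i τ x} → MinimalNullity H i τ → x ∈ τ → OnCycle H τ x
    minimal⇒OnCycle {τ = τ} {x} (nullity , minimal) x∈τ with OnCycle? H τ x
    ... | yes cycle = cycle
    ... | no ¬cycle = contradiction
      (minimal (τ - x) (p─q⊆p τ ⁅ x ⁆) (nullity-remove-coloop x∈τ ¬cycle nullity) x∈τ) (x∉p-x τ x)

  module KernelRestriction {N n r₁ r₂ : ℕ}
    (H₁ : Fin r₁ → Fin N → Carrier) (H₂ : Fin r₂ → Fin n → Carrier)
    (ι : Fin n → Fin N) (ι-inj : ∀ a b → ι a ≡ ι b → a ≡ b)
    (ker-restrict : ∀ {x} → Ker H₁ x → Ker H₂ (x ∘ ι))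
    (ker-restrict-injective : ∀ {x} → Ker H₁ x → (∀ a → x (ι a) ≈ 0#) → ∀ p → x p ≈ 0#)
    where

    -- An independent set of restrict ι τ, completed by the part of τ off the image of ι,
    -- stays independent for H₁.
    nullity-≤-restrict : ∀ {τ i j} → HasNullity H₁ τ i → HasNullity H₂ (restrict ι τ) j → i ≤ j
    nullity-≤-restrict {τ} {i} {j} (k , rk , ∣τ∣≡) (_ , ((I , I⊆ , indepI , refl) , _) , ∣τ₂∣≡) =
      m+i≡n+j∧n≤m⇒i≤j size (ℕₚ.+-monoˡ-≤ ∣ I ∣ (proj₂ rk J (glue-⊆ ι I⊆) indepJ))
      where
      open ≡.≡-Reasoning
      J = glue ι I τ
      indepJ : IndepCols H₁ J
      indepJ x sx kx = ker-restrict-injective kx (indepI (x ∘ ι) sxι (ker-restrict kx))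
        where
        sxι : SuppIn (x ∘ ι) I
        sxι a a∉I = sx (ι a) λ ιa∈J →
          a∉I (lookup⇒∈ (trans (sym (lookup-glue-image ι-inj I τ a)) (∈⇒lookup ιa∈J)))
      size : (k + ∣ I ∣) + i ≡ (∣ J ∣ + ∣ I ∣) + j
      size = begin
        (k + ∣ I ∣) + i              ≡⟨ xy∙z≈xz∙y k ∣ I ∣ i ⟩
        (k + i) + ∣ I ∣              ≡⟨ cong (_+ ∣ I ∣) ∣τ∣≡ ⟨
        ∣ τ ∣ + ∣ I ∣                ≡⟨ cong (λ A → ∣ τ ∣ + ∣ A ∣) (restrict-glue ι ι-inj I τ) ⟨
        ∣ τ ∣ + ∣ restrict ι J ∣     ≡⟨ ∣Y∣+∣Z∣ι≡∣Z∣+∣Y∣ι ι ι-inj {J} {τ} (lookup-glue-off ι-inj I τ) ⟨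
        ∣ J ∣ + ∣ restrict ι τ ∣     ≡⟨ cong (∣ J ∣ +_) ∣τ₂∣≡ ⟩
        ∣ J ∣ + (∣ I ∣ + j)          ≡⟨ ℕₚ.+-assoc ∣ J ∣ ∣ I ∣ j ⟨
        (∣ J ∣ + ∣ I ∣) + j          ∎

    restrict-OnCycle : ∀ {τ a} → OnCycle H₁ τ (ι a) → OnCycle H₂ (restrict ι τ) a
    restrict-OnCycle (x , kx , sx , xιa≉0) =
      x ∘ ι , ker-restrict kx , (λ b b∉ → sx (ι b) (b∉ ∘ ∈-restrict⁺ ι)) , xιa≉0

    minimal-restrict : ∀ {τ i j} → MinimalNullity H₁ i τ → HasNullity H₂ (restrict ι τ) j →
      ∀ τ′ → τ′ ⊆ restrict ι τ → HasNullity H₂ τ′ j → restrict ι τ ⊆ τ′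
    minimal-restrict {τ} {j = j} minimal₁ nullity₂ τ′ τ′⊆ nullity′ {x} x∈ with x ∈? τ′
    ... | yes x∈τ′ = x∈τ′
    ... | no x∉τ′ with basis-exists H₂ (restrict ι τ - x)
    ...   | I′ , basis′ = contradiction (nullity-remove-cycle H₂ x∈ cycle nullity₂ nullity-x) (ℕₚ.<⇒≢ (s≤s j≤))
      where
      nullity-x = basis⇒nullity H₂ basis′
      cycle = restrict-OnCycle (minimal⇒OnCycle H₁ minimal₁ (∈-restrict⁻ ι x∈))
      τ′⊆τ₂-x : τ′ ⊆ restrict ι τ - x
      τ′⊆τ₂-x y∈ = x∈p∧x≢y⇒x∈p-y (τ′⊆ y∈) λ { refl → x∉τ′ y∈ }
      j≤ : j ≤ ∣ restrict ι τ - x ∣ ∸ ∣ I′ ∣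
      j≤ = nullity-mono H₂ τ′⊆τ₂-x nullity′ nullity-x

    minimalNullity-restrict : ∀ {i τ} → MinimalNullity H₁ i τ →
      ∃[ j ] (i ≤ j × MinimalNullity H₂ j (restrict ι τ))
    minimalNullity-restrict {τ = τ} minimal₁@(nullity₁ , _) with basis-exists H₂ (restrict ι τ)
    ... | _ , basis = _ , nullity-≤-restrict nullity₁ nullity₂ , nullity₂ , minimal-restrict minimal₁ nullity₂
      where
      nullity₂ = basis⇒nullity H₂ basis

module Polynomials {c ℓ : Level} {q : ℕ} (F : FiniteField c ℓ q) where
  open FiniteField F hiding (zero; refl; sym; trans; _-_)
  open FiniteField F using () renaming (refl to ≈-refl; sym to ≈-sym; trans to ≈-trans)
  open Over F
  open import Algebra.Properties.Semiring.Exp semiring using (_^_; ^-congˡ; ^-homo-*)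
  open import Algebra.Properties.CommutativeSemiring.Exp commutativeSemiring using (^-distrib-*)
  open import Algebra.Properties.CommutativeSemigroup *-commutativeSemigroup
    using (interchange; x∙yz≈y∙xz)
  open import Algebra.Properties.CommutativeSemigroup ℕₚ.+-commutativeSemigroup
    using () renaming (x∙yz≈y∙xz to ℕ-x∙yz≈y∙xz)
  open import Algebra.Properties.CommutativeSemigroup +-commutativeSemigroup
    using () renaming (interchange to +-interchange; xy∙z≈xz∙y to +-xy∙z≈xz∙y)
  open import Algebra.Properties.Ring ring using (-‿distribˡ-*; x∙y⁻¹≈ε⇒x≈y)
  open LinearAlgebra F using (x≉0∧x*y≈0⇒y≈0)
  open import Relation.Binary.Reasoning.Setoid setoid

  degree-punchIn : ∀ {n} (k : Fin (suc n)) (e : Fin (suc n) → ℕ) → degree e ≡ e k ℕ.+ degree (e ∘ punchIn k)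
  degree-punchIn zero e = refl
  degree-punchIn {suc n} (suc k) e =
    trans (cong (e zero ℕ.+_) (degree-punchIn k (e ∘ suc))) (ℕ-x∙yz≈y∙xz (e zero) (e (suc k)) _)

  degree∘punchIn≤degree : ∀ {n} (k : Fin (suc n)) (e : Fin (suc n) → ℕ) → degree (e ∘ punchIn k) ≤ degree e
  degree∘punchIn≤degree k e = ℕₚ.≤-trans (ℕₚ.m≤n+m _ (e k)) (ℕₚ.≤-reflexive (sym (degree-punchIn k e)))

  prodFin-cong : ∀ {n} {f g : Fin n → Carrier} → (∀ i → f i ≈ g i) → prodFin f ≈ prodFin g
  prodFin-cong {zero} f≈g = ≈-refl
  prodFin-cong {suc n} f≈g = *-cong (f≈g zero) (prodFin-cong (f≈g ∘ suc))

  prodFin-punchIn : ∀ {n} (k : Fin (suc n)) (f : Fin (suc n) → Carrier) →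
    prodFin f ≈ f k * prodFin (f ∘ punchIn k)
  prodFin-punchIn zero f = ≈-refl
  prodFin-punchIn {suc n} (suc k) f =
    ≈-trans (*-congˡ (prodFin-punchIn k (f ∘ suc))) (x∙yz≈y∙xz (f zero) (f (suc k)) _)

  pow≡^ : ∀ x n → pow x n ≡ x ^ n
  pow≡^ x zero = refl
  pow≡^ x (suc n) = cong (x *_) (pow≡^ x n)

  pow-cong : ∀ {x y} n → x ≈ y → pow x n ≈ pow y n
  pow-cong {x} {y} n x≈y = begin
    pow x n ≡⟨ pow≡^ x n ⟩
    x ^ n   ≈⟨ ^-congˡ n x≈y ⟩
    y ^ n   ≡⟨ pow≡^ y n ⟨
    pow y n ∎

  pow-+ : ∀ x m n → pow x (m ℕ.+ n) ≈ pow x m * pow x n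
  pow-+ x m n = begin
    pow x (m ℕ.+ n)    ≡⟨ pow≡^ x (m ℕ.+ n) ⟩
    x ^ (m ℕ.+ n)      ≈⟨ ^-homo-* x m n ⟩
    x ^ m * x ^ n      ≡⟨ cong₂ _*_ (pow≡^ x m) (pow≡^ x n) ⟨
    pow x m * pow x n  ∎

  pow-distrib-* : ∀ x y n → pow (x * y) n ≈ pow x n * pow y n
  pow-distrib-* x y n = begin
    pow (x * y) n      ≡⟨ pow≡^ (x * y) n ⟩
    (x * y) ^ n        ≈⟨ ^-distrib-* x y n ⟩
    x ^ n * y ^ n      ≡⟨ cong₂ _*_ (pow≡^ x n) (pow≡^ y n) ⟨
    pow x n * pow y n  ∎

  pow-1# : ∀ n → pow 1# n ≈ 1#
  pow-1# zero = ≈-refl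
  pow-1# (suc n) = ≈-trans (*-identityˡ _) (pow-1# n)

  evalMon-scale : ∀ {n} (e : Fin n → ℕ) t (x : Vector n) →
    evalMon e (λ j → t * x j) ≈ pow t (degree e) * evalMon e x
  evalMon-scale {zero} e t x = ≈-sym (*-identityˡ 1#)
  evalMon-scale {suc n} e t x = begin
    pow (t * x zero) (e zero) * evalMon (e ∘ suc) (λ j → t * x (suc j))
      ≈⟨ *-cong (pow-distrib-* t (x zero) (e zero)) (evalMon-scale (e ∘ suc) t (x ∘ suc)) ⟩
    (pow t (e zero) * pow (x zero) (e zero)) * (pow t (degree (e ∘ suc)) * evalMon (e ∘ suc) (x ∘ suc))
      ≈⟨ interchange _ _ _ _ ⟩
    (pow t (e zero) * pow t (degree (e ∘ suc))) * (pow (x zero) (e zero) * evalMon (e ∘ suc) (x ∘ suc))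
      ≈⟨ *-congʳ (pow-+ t (e zero) _) ⟨
    pow t (degree e) * evalMon e x ∎

  evalMon-dehomogenise : ∀ {n} (k : Fin (suc n)) (e : Fin (suc n) → ℕ) {x : Vector (suc n)} → x k ≈ 1# →
    evalMon e x ≈ evalMon (e ∘ punchIn k) (x ∘ punchIn k)
  evalMon-dehomogenise k e {x} xk≈1 = begin
    evalMon e x                                                ≈⟨ prodFin-punchIn k (λ j → pow (x j) (e j)) ⟩
    pow (x k) (e k) * evalMon (e ∘ punchIn k) (x ∘ punchIn k)  ≈⟨ *-congʳ (≈-trans (pow-cong (e k) xk≈1) (pow-1# (e k))) ⟩
    1# * evalMon (e ∘ punchIn k) (x ∘ punchIn k)               ≈⟨ *-identityˡ _ ⟩
    evalMon (e ∘ punchIn k) (x ∘ punchIn k)                    ∎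

  evalMon-cong : ∀ {n} (e : Fin n → ℕ) {x y : Vector n} → (∀ j → x j ≈ y j) → evalMon e x ≈ evalMon e y
  evalMon-cong e x≈y = prodFin-cong λ j → pow-cong (e j) (x≈y j)

  eval-cong : ∀ {n} (f : Poly n) {x y : Vector n} → (∀ j → x j ≈ y j) → eval f x ≈ eval f y
  eval-cong [] x≈y = ≈-refl
  eval-cong ((a , e) ∷ f) x≈y = +-cong (*-congˡ (evalMon-cong e x≈y)) (eval-cong f x≈y)

  eval-homogeneous : ∀ {n d} {f : Poly n} → Homogeneous d f → ∀ t (x : Vector n) →
    eval f (λ j → t * x j) ≈ pow t d * eval f x
  eval-homogeneous {f = []} [] t x = ≈-sym (zeroʳ _)
  eval-homogeneous {d = d} {(a , e) ∷ f} (refl ∷ hf) t x = begin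
    a * evalMon e (λ j → t * x j) + eval f (λ j → t * x j)
      ≈⟨ +-cong (*-congˡ (evalMon-scale e t x)) (eval-homogeneous hf t x) ⟩
    a * (pow t d * evalMon e x) + pow t d * eval f x
      ≈⟨ +-congʳ (x∙yz≈y∙xz a _ _) ⟩
    pow t d * (a * evalMon e x) + pow t d * eval f x
      ≈⟨ distribˡ _ _ _ ⟨
    pow t d * (a * evalMon e x + eval f x) ∎

  -- Coefficients are listed from the constant term up, so Vec.last is the leading one.
  horner : ∀ {n} → Vec Carrier n → Carrier → Carrier
  horner [] t = 0#
  horner (a ∷ as) t = a + t * horner as t

  -- For p = a ∷ as, the coefficients of (p t − p α) / (t − α).
  quotient : ∀ {n} → Carrier → Vec Carrier n → Vec Carrier n
  quotient α [] = []
  quotient α (a ∷ as) = horner (a ∷ as) α ∷ quotient α as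

  division : ∀ {n} α a (as : Vec Carrier n) t →
    horner (a ∷ as) t + α * horner (quotient α as) t ≈ horner (a ∷ as) α + t * horner (quotient α as) t
  division α a [] t = +-xy∙z≈xz∙y a (t * 0#) (α * 0#)
  division α a (a′ ∷ as) t = begin
    (a + t * s t) + α * (s α + t * r)       ≈⟨ +-congˡ (distribˡ α (s α) (t * r)) ⟩
    (a + t * s t) + (α * s α + α * (t * r)) ≈⟨ +-interchange a (t * s t) (α * s α) (α * (t * r)) ⟩
    (a + α * s α) + (t * s t + α * (t * r)) ≈⟨ +-congˡ (+-congˡ (x∙yz≈y∙xz α t r)) ⟩
    (a + α * s α) + (t * s t + t * (α * r)) ≈⟨ +-congˡ (distribˡ t (s t) (α * r)) ⟨
    (a + α * s α) + t * (s t + α * r)       ≈⟨ +-congˡ (*-congˡ (division α a′ as t)) ⟩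
    (a + α * s α) + t * (s α + t * r)       ∎
    where
    s = horner (a′ ∷ as)
    r = horner (quotient α as) t

  last-quotient : ∀ {n} α (as : Vec Carrier (suc n)) → Vec.last (quotient α as) ≈ Vec.last as
  last-quotient α (a ∷ []) = ≈-trans (+-congˡ (zeroʳ α)) (+-identityʳ a)
  last-quotient α (a ∷ a′ ∷ as) = last-quotient α (a′ ∷ as)

  α*x≈β*x⇒x≈0 : ∀ {α β x} → ¬ β ≈ α → α * x ≈ β * x → x ≈ 0#
  α*x≈β*x⇒x≈0 {α} {β} {x} β≉α αx≈βx = x≉0∧x*y≈0⇒y≈0 (β≉α ∘ x∙y⁻¹≈ε⇒x≈y β α) (begin
    (β + - α) * x    ≈⟨ distribʳ x β (- α) ⟩
    β * x + - α * x  ≈⟨ +-congˡ (-‿distribˡ-* α x) ⟨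
    β * x + - (α * x) ≈⟨ +-congˡ (-‿cong αx≈βx) ⟩
    β * x + - (β * x) ≈⟨ -‿inverseʳ (β * x) ⟩
    0#               ∎)

  roots⇒last≈0 : ∀ d (p : Vec Carrier (suc d)) {L} (pt : Fin L → Carrier) → (∀ i j → pt i ≈ pt j → i ≡ j) →
    (∀ i → horner p (pt i) ≈ 0#) → suc d ≤ L → Vec.last p ≈ 0#
  roots⇒last≈0 zero (a ∷ []) pt _ root (s≤s _) =
    ≈-trans (≈-sym (≈-trans (+-congˡ (zeroʳ _)) (+-identityʳ a))) (root zero)
  roots⇒last≈0 (suc d) (a ∷ as) pt pt-inj root (s≤s d<L) =
    ≈-trans (≈-sym (last-quotient α as))
      (roots⇒last≈0 d (quotient α as) (pt ∘ suc) (λ i j eq → Finₚ.suc-injective (pt-inj _ _ eq)) root′ d<L)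
    where
    α = pt zero
    root′ : ∀ i → horner (quotient α as) (pt (suc i)) ≈ 0#
    root′ i = α*x≈β*x⇒x≈0 (λ β≈α → case pt-inj (suc i) zero β≈α of λ ()) (begin
      α * horner (quotient α as) β                          ≈⟨ +-identityˡ _ ⟨
      0# + α * horner (quotient α as) β                     ≈⟨ +-congʳ (root (suc i)) ⟨
      horner (a ∷ as) β + α * horner (quotient α as) β      ≈⟨ division α a as β ⟩
      horner (a ∷ as) α + β * horner (quotient α as) β      ≈⟨ +-congʳ (root zero) ⟩
      0# + β * horner (quotient α as) β                     ≈⟨ +-identityˡ _ ⟩
      β * horner (quotient α as) β                          ∎)
      where
      β = pt (suc i)

  horner-replicate-0# : ∀ n t → horner (Vec.replicate n 0#) t ≈ 0#
  horner-replicate-0# zero t = ≈-refl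
  horner-replicate-0# (suc n) t = ≈-trans (+-identityˡ _) (≈-trans (*-congˡ (horner-replicate-0# n t)) (zeroʳ t))

  last-replicate : ∀ n (x : Carrier) → Vec.last (Vec.replicate (suc n) x) ≡ x
  last-replicate zero x = refl
  last-replicate (suc n) x = last-replicate n x

  horner-+ : ∀ {n} (p p′ : Vec Carrier n) t → horner (Vec.zipWith _+_ p p′) t ≈ horner p t + horner p′ t
  horner-+ [] [] t = ≈-sym (+-identityˡ 0#)
  horner-+ (a ∷ p) (a′ ∷ p′) t = begin
    (a + a′) + t * horner (Vec.zipWith _+_ p p′) t  ≈⟨ +-congˡ (*-congˡ (horner-+ p p′ t)) ⟩
    (a + a′) + t * (horner p t + horner p′ t)       ≈⟨ +-congˡ (distribˡ t _ _) ⟩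
    (a + a′) + (t * horner p t + t * horner p′ t)   ≈⟨ +-interchange a a′ _ _ ⟩
    (a + t * horner p t) + (a′ + t * horner p′ t)   ∎

  last-+ : ∀ {n} (p p′ : Vec Carrier (suc n)) → Vec.last (Vec.zipWith _+_ p p′) ≡ Vec.last p + Vec.last p′
  last-+ (a ∷ []) (a′ ∷ []) = refl
  last-+ (a ∷ b ∷ p) (a′ ∷ b′ ∷ p′) = last-+ (b ∷ p) (b′ ∷ p′)

  monomial : ∀ {s d} → s ≤ d → Carrier → Vec Carrier (suc d)
  monomial {d = d} z≤n x = x ∷ Vec.replicate d 0#
  monomial (s≤s s≤d) x = 0# ∷ monomial s≤d x

  horner-monomial : ∀ {s d} (s≤d : s ≤ d) x t → horner (monomial s≤d x) t ≈ pow t s * x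
  horner-monomial {d = d} z≤n x t = begin
    x + t * horner (Vec.replicate d 0#) t ≈⟨ +-congˡ (≈-trans (*-congˡ (horner-replicate-0# d t)) (zeroʳ t)) ⟩
    x + 0#                                ≈⟨ +-identityʳ x ⟩
    x                                     ≈⟨ *-identityˡ x ⟨
    1# * x                                ∎
  horner-monomial (s≤s {s} s≤d) x t = begin
    0# + t * horner (monomial s≤d x) t    ≈⟨ +-identityˡ _ ⟩
    t * horner (monomial s≤d x) t         ≈⟨ *-congˡ (horner-monomial s≤d x t) ⟩
    t * (pow t s * x)                     ≈⟨ *-assoc t (pow t s) x ⟨
    pow t (suc s) * x                     ∎

  last-monomial-≡ : ∀ {s d} (s≤d : s ≤ d) x → s ≡ d → Vec.last (monomial s≤d x) ≈ x
  last-monomial-≡ z≤n x refl = ≈-refl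
  last-monomial-≡ (s≤s s≤d) x refl = last-monomial-≡ s≤d x refl

  last-monomial-< : ∀ {s d} (s≤d : s ≤ d) x → s < d → Vec.last (monomial s≤d x) ≈ 0#
  last-monomial-< {d = suc d} z≤n x _ = reflexive (last-replicate d 0#)
  last-monomial-< (s≤s s≤d) x (s≤s s<d) = last-monomial-< s≤d x s<d

  module _ {m : ℕ} (k : Fin (suc m)) (v : Vector (suc m)) where

    line : Carrier → Vector (suc m)
    line t = insertAt (λ j → t * v (punchIn k j)) k 1#

    affineDegree : (Fin (suc m) → ℕ) → ℕ
    affineDegree e = degree (e ∘ punchIn k)

    affineValue : (Fin (suc m) → ℕ) → Carrier
    affineValue e = evalMon (e ∘ punchIn k) (v ∘ punchIn k)

    affineDegree≤ : ∀ {d} e → degree e ≡ d → affineDegree e ≤ d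
    affineDegree≤ e refl = degree∘punchIn≤degree k e

    evalMon-line : ∀ e t → evalMon e (line t) ≈ pow t (affineDegree e) * affineValue e
    evalMon-line e t = begin
      evalMon e (line t)
        ≈⟨ evalMon-dehomogenise k e {line t} (reflexive (insertAt-lookup (λ j → t * v (punchIn k j)) k 1#)) ⟩
      evalMon (e ∘ punchIn k) (line t ∘ punchIn k)
        ≈⟨ evalMon-cong (e ∘ punchIn k) (λ j → reflexive (insertAt-punchIn (λ j → t * v (punchIn k j)) k 1# j)) ⟩
      evalMon (e ∘ punchIn k) (λ j → t * v (punchIn k j))
        ≈⟨ evalMon-scale (e ∘ punchIn k) t (v ∘ punchIn k) ⟩
      pow t (affineDegree e) * affineValue e ∎

    alongLine : ∀ {d} (f : Poly (suc m)) → Homogeneous d f → Vec Carrier (suc d)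
    alongLine {d} [] [] = Vec.replicate (suc d) 0#
    alongLine ((a , e) ∷ f) (de ∷ hf) =
      Vec.zipWith _+_ (monomial (affineDegree≤ e de) (a * affineValue e)) (alongLine f hf)

    horner-alongLine : ∀ {d} f (hf : Homogeneous d f) t → horner (alongLine f hf) t ≈ eval f (line t)
    horner-alongLine {d} [] [] t = horner-replicate-0# (suc d) t
    horner-alongLine ((a , e) ∷ f) (de ∷ hf) t = begin
      horner (Vec.zipWith _+_ mono (alongLine f hf)) t      ≈⟨ horner-+ mono (alongLine f hf) t ⟩
      horner mono t + horner (alongLine f hf) t            ≈⟨ +-cong (horner-monomial (affineDegree≤ e de) _ t)
                                                                       (horner-alongLine f hf t) ⟩
      pow t (affineDegree e) * (a * affineValue e) + eval f (line t)
                                                           ≈⟨ +-congʳ (x∙yz≈y∙xz _ a _) ⟩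
      a * (pow t (affineDegree e) * affineValue e) + eval f (line t)
                                                           ≈⟨ +-congʳ (*-congˡ (evalMon-line e t)) ⟨
      a * evalMon e (line t) + eval f (line t)             ∎
      where
      mono = monomial (affineDegree≤ e de) (a * affineValue e)

    -- When v k = 0 the leading coefficient is f v: only monomials free of x_k survive at v.
    last-alongLine : ∀ {d} f (hf : Homogeneous d f) → v k ≈ 0# → Vec.last (alongLine f hf) ≈ eval f v
    last-alongLine {d} [] [] vk≈0 = reflexive (last-replicate d 0#)
    last-alongLine {d} ((a , e) ∷ f) (de ∷ hf) vk≈0 = begin
      Vec.last (Vec.zipWith _+_ mono (alongLine f hf))   ≡⟨ last-+ mono (alongLine f hf) ⟩
      Vec.last mono + Vec.last (alongLine f hf)          ≈⟨ +-cong (leading-term (e k) refl)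
                                                                  (last-alongLine f hf vk≈0) ⟩
      a * evalMon e v + eval f v                         ∎
      where
      mono = monomial (affineDegree≤ e de) (a * affineValue e)
      evalMon≈ : evalMon e v ≈ pow (v k) (e k) * affineValue e
      evalMon≈ = prodFin-punchIn k (λ j → pow (v j) (e j))
      degree≡ : ∀ {n} → e k ≡ n → d ≡ n ℕ.+ affineDegree e
      degree≡ ek≡n = trans (sym de) (trans (degree-punchIn k e) (cong (ℕ._+ affineDegree e) ek≡n))
      leading-term : ∀ n → e k ≡ n → Vec.last mono ≈ a * evalMon e v
      leading-term zero ek≡0 = begin
        Vec.last mono          ≈⟨ last-monomial-≡ (affineDegree≤ e de) _ (sym (degree≡ ek≡0)) ⟩
        a * affineValue e
          ≈⟨ *-congˡ (≈-trans (*-congʳ (reflexive (cong (pow (v k)) ek≡0))) (*-identityˡ _)) ⟨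
        a * (pow (v k) (e k) * affineValue e) ≈⟨ *-congˡ evalMon≈ ⟨
        a * evalMon e v        ∎
      leading-term (suc n) ek≡1+n = begin
        Vec.last mono          ≈⟨ last-monomial-< (affineDegree≤ e de) _ affineDegree<d ⟩
        0#                     ≈⟨ zeroʳ a ⟨
        a * 0#                 ≈⟨ *-congˡ evalMon≈0 ⟨
        a * evalMon e v        ∎
        where
        affineDegree<d : affineDegree e < d
        affineDegree<d = ℕₚ.≤-trans (s≤s (ℕₚ.m≤n+m (affineDegree e) n)) (ℕₚ.≤-reflexive (sym (degree≡ ek≡1+n)))
        evalMon≈0 : evalMon e v ≈ 0#
        evalMon≈0 = begin
          evalMon e v                            ≈⟨ evalMon≈ ⟩
          pow (v k) (e k) * affineValue e        ≡⟨ cong (λ n → pow (v k) n * affineValue e) ek≡1+n ⟩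
          (v k * pow (v k) n) * affineValue e    ≈⟨ *-congʳ (≈-trans (*-congʳ vk≈0) (zeroˡ _)) ⟩
          0# * affineValue e                     ≈⟨ zeroˡ _ ⟩
          0#                                     ∎

  homogeneous-vanishing : ∀ {m d} (k : Fin (suc m)) {f : Poly (suc m)} → Homogeneous d f → d < q →
    (∀ u → u k ≈ 1# → eval f u ≈ 0#) → ∀ v → v k ≈ 0# → eval f v ≈ 0#
  homogeneous-vanishing {d = d} k {f} hf d<q vanish v vk≈0 =
    ≈-trans (≈-sym (last-alongLine k v f hf vk≈0))
      (roots⇒last≈0 d (alongLine k v f hf) enum enum-inj root d<q)
    where
    root : ∀ i → horner (alongLine k v f hf) (enum i) ≈ 0#
    root i = ≈-trans (horner-alongLine k v f hf (enum i))
      (vanish (line k v (enum i)) (reflexive (insertAt-lookup (λ j → enum i * v (punchIn k j)) k 1#)))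

module ReedMuller {c ℓ : Level} {q : ℕ} (F : FiniteField c ℓ q) where
  open FiniteField F hiding (zero; refl; sym; trans; _-_)
  open FiniteField F using () renaming (refl to ≈-refl; sym to ≈-sym; trans to ≈-trans)
  open Over F
  open LinearAlgebra F using (_≈?_)
  open Polynomials F

  dehomogenise : ∀ {m} → Fin (suc m) → Poly (suc m) → Poly m
  dehomogenise k = List.map (map₂ (_∘ punchIn k))

  dehomogenise-degree : ∀ {m d} (k : Fin (suc m)) {f} → Homogeneous d f → DegAtMost d (dehomogenise k f)
  dehomogenise-degree k = gmap⁺ λ { {_ , e} refl → degree∘punchIn≤degree k e }

  eval-dehomogenise : ∀ {m} (k : Fin (suc m)) f {x : Vector (suc m)} → x k ≈ 1# →
    eval f x ≈ eval (dehomogenise k f) (x ∘ punchIn k)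
  eval-dehomogenise k [] xk≈1 = ≈-refl
  eval-dehomogenise k ((a , e) ∷ f) {x} xk≈1 =
    +-cong (*-congˡ (evalMon-dehomogenise k e {x} xk≈1)) (eval-dehomogenise k f xk≈1)

  module _ {m d N n : ℕ} {rep : Fin N → Vector (suc m)} {k : Fin (suc m)} {ι : Fin n → Fin N} where

    PRM⇒RM : (∀ a → rep (ι a) k ≈ 1#) → ∀ {x} → PRM d m rep x → RM d m (λ a → rep (ι a) ∘ punchIn k) (x ∘ ι)
    PRM⇒RM affine (f , hf , x≈f) =
      dehomogenise k f , dehomogenise-degree k hf , λ a → ≈-trans (x≈f (ι a)) (eval-dehomogenise k f (affine a))

    PRM-affine-vanishing : d < q → IsProjReps m N rep → (∀ p → ¬ rep p k ≈ 0# → ∃[ a ] ι a ≡ p) →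
      ∀ {x} → PRM d m rep x → (∀ a → x (ι a) ≈ 0#) → ∀ p → x p ≈ 0#
    PRM-affine-vanishing d<q (_ , represent , _) affine (f , hf , x≈f) x∘ι≈0 p
      with rep p k ≈? 0#
    ... | no pk≉0 with affine p pk≉0
    ...   | a , refl = x∘ι≈0 a
    PRM-affine-vanishing d<q (_ , represent , _) affine (f , hf , x≈f) x∘ι≈0 p | yes pk≈0 =
      ≈-trans (x≈f p) (homogeneous-vanishing k hf d<q vanish (rep p) pk≈0)
      where
      f∘rep∘ι≈0 : ∀ a → eval f (rep (ι a)) ≈ 0#
      f∘rep∘ι≈0 a = ≈-trans (≈-sym (x≈f (ι a))) (x∘ι≈0 a)
      vanish : ∀ u → u k ≈ 1# → eval f u ≈ 0#
      vanish u uk≈1 with represent u (λ u≈0 → 0≉1 (≈-trans (≈-sym (u≈0 k)) uk≈1))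
      ... | p′ , λ′ , u≈λ′p′ with affine p′ p′k≉0
        where
        p′k≉0 : ¬ rep p′ k ≈ 0#
        p′k≉0 p′k≈0 = 0≉1 (≈-trans (≈-sym (≈-trans (u≈λ′p′ k) (≈-trans (*-congˡ p′k≈0) (zeroʳ λ′)))) uk≈1)
      ...   | a , refl = begin
        eval f u                       ≈⟨ eval-cong f u≈λ′p′ ⟩
        eval f (λ j → λ′ * rep (ι a) j) ≈⟨ eval-homogeneous hf λ′ (rep (ι a)) ⟩
        pow λ′ d * eval f (rep (ι a))  ≈⟨ *-congˡ (f∘rep∘ι≈0 a) ⟩
        pow λ′ d * 0#                  ≈⟨ zeroʳ _ ⟩
        0#                             ∎
        where open import Relation.Binary.Reasoning.Setoid setoid

propositionA3 : ∀ {c ℓ : Level} {q : ℕ} (F : FiniteField c ℓ q) → IsPrimePower q →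
    let open FiniteField F in
    let open Over F in
    (m d : ℕ) → d < q →
    (N : ℕ) (rep : Fin N → Vector (suc m)) → IsProjReps m N rep →
    (k : Fin (suc m)) → (∀ p → ¬ (rep p k ≈ 0#) → rep p k ≈ 1#) →
    (n₂ : ℕ) (ι : Fin n₂ → Fin N) → (∀ a b → ι a ≡ ι b → a ≡ b) →
    (∀ p → ¬ (rep p k ≈ 0#) → ∃[ a ] (ι a ≡ p)) →
    (∀ a → ¬ (rep (ι a) k ≈ 0#)) →
    {r₁ r₂ : ℕ} (H₁ : Fin r₁ → Fin N → FiniteField.Carrier F) →
    IsParityCheck (PRM d m rep) H₁ →
    (H₂ : Fin r₂ → Fin n₂ → FiniteField.Carrier F) →
    IsParityCheck (RM d m (λ a t → rep (ι a) (punchIn k t))) H₂ →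
    (i : ℕ) → (∃[ R ] (IsRank H₁ ⊤ R × i ≤ R)) →
    (σ₁ : Subset N) → MinimalNullity H₁ i (∁ σ₁) →
    ∃[ j ] (i ≤ j × MinimalNullity H₂ j (∁ (restrict ι σ₁)))
propositionA3 F _ m d d<q N rep reps k affine-1 n₂ ι ι-inj affine-ι ι-affine H₁ PC₁ H₂ PC₂ i _ σ₁ minimal =
  subst (λ τ → ∃[ j ] (i ≤ j × MinimalNullity H₂ j τ)) (restrict-∁ ι σ₁)
    (KernelRestriction.minimalNullity-restrict H₁ H₂ ι ι-inj restrict-Ker restrict-Ker-injective minimal)
  where
  open FiniteField F using (_≈_; 0#)
  open Over F
  open LinearAlgebra F
  open ParityCheckMatroid F
  open Restriction F
  open ReedMuller F
  restrict-Ker : ∀ {x} → Ker H₁ x → Ker H₂ (x ∘ ι)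
  restrict-Ker Kx =
    parityCheck⇒Ker H₂ PC₂ (PRM⇒RM (λ a → affine-1 (ι a) (ι-affine a)) (Ker⇒parityCheck H₁ PC₁ Kx))
  restrict-Ker-injective : ∀ {x} → Ker H₁ x → (∀ a → x (ι a) ≈ 0#) → ∀ p → x p ≈ 0#
  restrict-Ker-injective Kx = PRM-affine-vanishing d<q reps affine-ι (Ker⇒parityCheck H₁ PC₁ Kx)
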